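{- For every $n\ge 1$, the $n\times n$ grid $G_{n\times n}$, with its standard plane embedding, satisfies $\pi_f(G_{n\times n})\le 4$.
   Context: The $n\times n$ grid is the Cartesian product $P_n\square P_n$ of two $n$-vertex paths, embedded in the plane in the standard way (vertices at integer points, inner faces are unit squares). A sequence $s_1,\dots,s_k,s_1,\dots,s_k$ (with $k\ge 1$) is a repetition; a sequence is nonrepetitive if no block of consecutive terms forms a repetition. A facial path is a path consisting of consecutive vertices on the boundary of a face. A facial nonrepetitive vertex coloring is a vertex coloring such that the sequence of colors along every facial path is nonrepetitive. $\pi_f(G)$ is the minimum number of colors in a facial nonrepetitive vertex coloring of the plane graph $G$. -}

module Defs where

open import Data.Nat using (ℕ; zero; suc; _+_; _∸_; _<_; _≤_)
open import Data.Fin using (Fin)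
import Data.Fin as F
open import Data.List using (List; []; _∷_; _++_; map; take; drop; length; reverse; concatMap; upTo; applyUpTo)
open import Data.List.Membership.Propositional using (_∈_)
open import Data.Product using (_×_; _,_; Σ; ∃; ∃-syntax)
open import Relation.Binary.PropositionalEquality using (_≡_)
open import Relation.Nullary using (¬_)

Repetition : ∀ {A : Set} → List A → Set
Repetition {A} xs = Σ (List A) λ ys → (1 ≤ length ys) × (xs ≡ ys ++ ys)

Nonrepetitive : ∀ {A : Set} → List A → Set
Nonrepetitive {A} xs = ∀ (as bs cs : List A) → xs ≡ as ++ bs ++ cs → ¬ Repetition bs

Vertex : ℕ → Set
Vertex m = ℕ × ℕ   -- coordinates; all listed vertices satisfy x , y ≤ m

squareFace : ℕ → ℕ → List (ℕ × ℕ)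
squareFace i j = (i , j) ∷ (suc i , j) ∷ (suc i , suc j) ∷ (i , suc j) ∷ []

outerFace : ℕ → List (ℕ × ℕ)
outerFace zero = (0 , 0) ∷ []
outerFace m@(suc _) =
     applyUpTo (λ i → (i , 0)) m
  ++ applyUpTo (λ j → (m , j)) m
  ++ applyUpTo (λ i → (m ∸ i , m)) m
  ++ applyUpTo (λ j → (0 , m ∸ j)) m

gridFaces : ℕ → List (List (ℕ × ℕ))
gridFaces m = outerFace m ∷ concatMap (λ i → map (λ j → squareFace i j) (upTo m)) (upTo m)

-- facial paths of a face with cyclic boundary B: k consecutive boundary
-- vertices (1 ≤ k ≤ |B|) starting at position s, traversed in either direction
FacialPathOf : ∀ {A : Set} → List A → List A → Set
FacialPathOf B P = ∃[ s ] ∃[ k ] (s < length B) × (1 ≤ k) × (k ≤ length B) ×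
  ((P ≡ take k (drop s (B ++ B))) Data.Sum.⊎ (P ≡ reverse (take k (drop s (B ++ B)))))
  where import Data.Sum

FacialPath : ℕ → List (ℕ × ℕ) → Set
FacialPath m P = ∃[ B ] (B ∈ gridFaces m) × FacialPathOf B P

-- reading a coloring of Fin (suc m) × Fin (suc m) at natural coordinates
-- (coordinates are always ≤ m on the faces above; clamping is never used)
clamp : ∀ {m} → ℕ → Fin (suc m)
clamp {zero} _ = F.zero
clamp {suc m} zero = F.zero
clamp {suc m} (suc x) = F.suc (clamp {m} x)

colorAt : ∀ {m} {C : Set} → (Fin (suc m) → Fin (suc m) → C) → ℕ × ℕ → C
colorAt c (x , y) = c (clamp x) (clamp y)

FacialNonrepetitive : ∀ {m} {C : Set} → (Fin (suc m) → Fin (suc m) → C) → Set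
FacialNonrepetitive {m} c = ∀ P → FacialPath m P → Nonrepetitive (map (colorAt c) P)

πf-grid-≤ : ℕ → ℕ → Set
πf-grid-≤ n k = ∀ {m} → n ≡ suc m →
  Σ (Fin (suc m) → Fin (suc m) → Fin k) FacialNonrepetitive

module Submission where

-- Thue's overlap-freeness of the Thue–Morse sequence tm gives
-- the square-free word vtm over {cA, cC, cD} (colour the pair tm n, tm (n+1)).
-- The boundary gets the cyclic word W = cB vtm(2) vtm(3) …: the single
-- marker cB cannot be matched inside a square, so the cyclic word has no
-- square of period at most half its length, which is what the facial paths
-- of the outer face see.
--
-- A facial path of a unit square is nonrepetitive iff the
-- square is "good": consecutive colours differ and the two diagonals are not
-- both monochromatic.  The interior vertex (x, y) gets a colour coding the
-- parities of its ring (distance to the boundary) and of x + y; this is good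
-- on every unit square except the central square of an odd grid, which is
-- repaired by a 4×4 patch.  Squares touching the boundary are good because W
-- avoids cB and avoids cA at odd positions.  Grids with m ≤ 6 and the patch
-- are checked by evaluation.

open import Defs
open import Data.Nat using (ℕ; zero; suc; _+_; _∸_; _≤_; _<_; z≤n; s≤s; _⊓_; _≟_; _≤ᵇ_; pred; ⌊_/2⌋)
open import Data.Nat.Properties
open import Data.Nat.Induction using (<-rec)
open import Data.Nat.Tactic.RingSolver using (solve-∀)
open import Data.Bool using (Bool; true; false; not; _xor_; if_then_else_; _∧_; T)
open import Data.Bool.Properties using (not-injective; not-¬; ¬-not; not-distribˡ-xor)
import Data.Bool.Properties as Bool
open import Data.Fin using (Fin; toℕ; fromℕ<) renaming (zero to 0F; suc to sF; _≟_ to _≟ᶠ_)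
open import Data.Fin.Properties using (all?; toℕ-fromℕ<)
open import Data.List using (List; []; _∷_; _++_; map; take; drop; length; reverse; upTo; applyUpTo)
open import Data.List.Properties using (length-++; length-take; length-map; length-applyUpTo; take-map; drop-map; reverse-++; reverse-map; map-++; length-reverse; reverse-involutive; ++-assoc)
open import Data.List.Membership.Propositional using (find)
open import Data.List.Membership.Propositional.Properties using (∈-concatMap⁻; ∈-map⁻; ∈-upTo⁻)
open import Data.List.Relation.Unary.Any using (here; there)
open import Data.Maybe using (Maybe; just; nothing)
import Data.Maybe as Maybe
open import Data.Maybe.Properties using (just-injective)
open import Data.Product using (_×_; _,_; ∃-syntax; proj₁; proj₂)
open import Data.Sum using (_⊎_; inj₁; inj₂)
open import Data.Empty using (⊥)
open import Data.Unit using (tt)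
open import Relation.Nullary using (¬_; Dec; yes; no; contradiction; ¬?)
open import Relation.Nullary.Decidable using (True; toWitness; _×-dec_; _→-dec_)
open import Relation.Binary.PropositionalEquality using (_≡_; _≢_; refl; sym; trans; cong; cong₂; subst; subst₂; module ≡-Reasoning)
open import Relation.Binary.Definitions using (tri<; tri≈; tri>)
open import Function using (_∘_)

open ≡-Reasoning

odd : ℕ → Bool
odd zero = false
odd (suc zero) = true
odd (suc (suc n)) = odd n

-- doubling, by recursion so that the halving view below computes
dbl : ℕ → ℕ
dbl zero = zero
dbl (suc n) = suc (suc (dbl n))

data Halving : ℕ → Set where
  twice   : ∀ h → Halving (dbl h)
  twice+1 : ∀ h → Halving (suc (dbl h))

halving : ∀ n → Halving n
halving zero = twice 0
halving (suc zero) = twice+1 0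
halving (suc (suc n)) with halving n
... | twice h = twice (suc h)
... | twice+1 h = twice+1 (suc h)

odd-suc : ∀ n → odd (suc n) ≡ not (odd n)
odd-suc zero = refl
odd-suc (suc zero) = refl
odd-suc (suc (suc n)) = odd-suc n

odd-+ : ∀ a b → odd (a + b) ≡ odd a xor odd b
odd-+ zero b = refl
odd-+ (suc a) b = begin
  odd (suc (a + b))       ≡⟨ odd-suc (a + b) ⟩
  not (odd (a + b))       ≡⟨ cong not (odd-+ a b) ⟩
  not (odd a xor odd b)   ≡⟨ not-distribˡ-xor (odd a) (odd b) ⟩
  not (odd a) xor odd b   ≡⟨ cong (_xor odd b) (odd-suc a) ⟨
  odd (suc a) xor odd b   ∎

odd-dbl : ∀ n → odd (dbl n) ≡ false
odd-dbl zero = refl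
odd-dbl (suc n) = odd-dbl n

odd-dbl+1 : ∀ n → odd (suc (dbl n)) ≡ true
odd-dbl+1 zero = refl
odd-dbl+1 (suc n) = odd-dbl+1 n

halve-dbl : ∀ n → ⌊ dbl n /2⌋ ≡ n
halve-dbl zero = refl
halve-dbl (suc n) = cong suc (halve-dbl n)

halve-dbl+1 : ∀ n → ⌊ suc (dbl n) /2⌋ ≡ n
halve-dbl+1 zero = refl
halve-dbl+1 (suc n) = cong suc (halve-dbl+1 n)

dbl-+ : ∀ a b → dbl a + dbl b ≡ dbl (a + b)
dbl-+ zero b = refl
dbl-+ (suc a) b = cong (suc ∘ suc) (dbl-+ a b)

dbl-+₃ : ∀ a b c → dbl a + dbl b + dbl c ≡ dbl (a + b + c)
dbl-+₃ a b c = trans (cong (_+ dbl c) (dbl-+ a b)) (dbl-+ (a + b) c)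

dbl-mono : ∀ {a b} → a ≤ b → dbl a ≤ dbl b
dbl-mono z≤n = z≤n
dbl-mono (s≤s a≤b) = s≤s (s≤s (dbl-mono a≤b))

dbl≡+ : ∀ n → dbl n ≡ n + n
dbl≡+ zero = refl
dbl≡+ (suc n) = cong suc (trans (cong suc (dbl≡+ n)) (sym (+-suc n n)))

-- The Thue–Morse sequence: tm n is the parity of the binary digit sum of
-- n, i.e. tm n = odd n xor tm ⌊n/2⌋.  It is computed with fuel f ≥ n.

tmFuel : ℕ → ℕ → Bool
tmFuel zero _ = false
tmFuel (suc f) n = odd n xor tmFuel f ⌊ n /2⌋

tm : ℕ → Bool
tm n = tmFuel n n

halve≤ : ∀ {n f} → n ≤ suc f → ⌊ n /2⌋ ≤ f
halve≤ {zero} _ = z≤n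
halve≤ {suc n} (s≤s n≤f) = ≤-trans (≤-pred (⌊n/2⌋<n n)) n≤f

tmFuel-irrelevant : ∀ f g n → n ≤ f → n ≤ g → tmFuel f n ≡ tmFuel g n
tmFuel-irrelevant zero zero _ _ _ = refl
tmFuel-irrelevant zero (suc g) zero _ _ = tmFuel-irrelevant zero g zero z≤n z≤n
tmFuel-irrelevant (suc f) zero zero _ _ = tmFuel-irrelevant f zero zero z≤n z≤n
tmFuel-irrelevant (suc f) (suc g) n n≤f n≤g =
  cong (odd n xor_) (tmFuel-irrelevant f g ⌊ n /2⌋ (halve≤ n≤f) (halve≤ n≤g))

tm-unfold : ∀ n → tm n ≡ odd n xor tm ⌊ n /2⌋
tm-unfold zero = refl
tm-unfold (suc n) = cong (odd (suc n) xor_)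
  (tmFuel-irrelevant n ⌊ suc n /2⌋ ⌊ suc n /2⌋ (halve≤ ≤-refl) ≤-refl)

tm-twice : ∀ n → tm (dbl n) ≡ tm n
tm-twice n = begin
  tm (dbl n)                                ≡⟨ tm-unfold (dbl n) ⟩
  odd (dbl n) xor tm ⌊ dbl n /2⌋            ≡⟨ cong₂ (λ a b → a xor tm b) (odd-dbl n) (halve-dbl n) ⟩
  tm n                                      ∎

tm-twice+1 : ∀ n → tm (suc (dbl n)) ≡ not (tm n)
tm-twice+1 n = begin
  tm (suc (dbl n))                              ≡⟨ tm-unfold (suc (dbl n)) ⟩
  odd (suc (dbl n)) xor tm ⌊ suc (dbl n) /2⌋    ≡⟨ cong₂ (λ a b → a xor tm b) (odd-dbl+1 n) (halve-dbl+1 n) ⟩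
  not (tm n)                                    ∎

tm-pair : ∀ e → odd e ≡ false → tm e ≢ tm (suc e)
tm-pair e oe eq with halving e
... | twice q = not-¬ refl (trans (sym (tm-twice q)) (trans eq (tm-twice+1 q)))
... | twice+1 q with () ← trans (sym (odd-dbl+1 q)) oe

-- Overlap-freeness of the Thue–Morse sequence (Thue): no factor of the
-- form a w a w a.  An overlap of period k at p means that tm agrees on
-- [p, p+k] and on [p+k, p+2k].

Overlap : ℕ → ℕ → Set
Overlap p k = ∀ i → i ≤ k → tm (p + i) ≡ tm (p + k + i)

-- period 1: three equal consecutive letters contain an aligned pair
overlap-1 : ∀ p → ¬ Overlap p 1
overlap-1 p ov with halving p
... | twice q = tm-pair (dbl q) (odd-dbl q) (begin
      tm (dbl q)          ≡⟨ cong tm (+-identityʳ (dbl q)) ⟨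
      tm (dbl q + 0)      ≡⟨ ov 0 z≤n ⟩
      tm (dbl q + 1 + 0)  ≡⟨ cong tm (trans (+-identityʳ _) (+-comm (dbl q) 1)) ⟩
      tm (suc (dbl q))    ∎)
... | twice+1 q = tm-pair (suc (suc (dbl q))) (odd-dbl q) (begin
      tm (suc (suc (dbl q)))      ≡⟨ cong tm (+-comm 1 (suc (dbl q))) ⟩
      tm (suc (dbl q) + 1)        ≡⟨ ov 1 ≤-refl ⟩
      tm (suc (dbl q) + 1 + 1)    ≡⟨ cong (tm ∘ suc) (trans (+-assoc (dbl q) 1 1) (+-comm (dbl q) 2)) ⟩
      tm (suc (suc (suc (dbl q)))) ∎)

overlap-halve : ∀ p h → Overlap p (dbl h) → ∃[ q ] Overlap q h
overlap-halve p h ov with halving p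
... | twice q = q , λ i i≤h → begin
      tm (q + i)                    ≡⟨ tm-twice (q + i) ⟨
      tm (dbl (q + i))              ≡⟨ cong tm (dbl-+ q i) ⟨
      tm (dbl q + dbl i)            ≡⟨ ov (dbl i) (dbl-mono i≤h) ⟩
      tm (dbl q + dbl h + dbl i)    ≡⟨ cong tm (dbl-+₃ q h i) ⟩
      tm (dbl (q + h + i))          ≡⟨ tm-twice (q + h + i) ⟩
      tm (q + h + i)                ∎
... | twice+1 q = q , λ i i≤h → not-injective (begin
      not (tm (q + i))                    ≡⟨ tm-twice+1 (q + i) ⟨
      tm (suc (dbl (q + i)))              ≡⟨ cong (tm ∘ suc) (dbl-+ q i) ⟨
      tm (suc (dbl q) + dbl i)            ≡⟨ ov (dbl i) (dbl-mono i≤h) ⟩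
      tm (suc (dbl q) + dbl h + dbl i)    ≡⟨ cong (tm ∘ suc) (dbl-+₃ q h i) ⟩
      tm (suc (dbl (q + h + i)))          ≡⟨ tm-twice+1 (q + h + i) ⟩
      not (tm (q + h + i))                ∎)

odd-+-odd : ∀ x k → odd k ≡ true → odd (x + k) ≡ not (odd x)
odd-+-odd x k ok = trans (odd-+ x k) (trans (cong (odd x xor_) ok) (Bool.xor-comm (odd x) true))

-- inside an overlap of odd period k every two consecutive letters differ:
-- of the positions p+i and p+i±k one is even and starts an aligned pair
overlap-odd-alternates : ∀ p k → odd k ≡ true → Overlap p k →
  ∀ i → suc i ≤ k + k → tm (p + i) ≢ tm (p + suc i)
overlap-odd-alternates p k ok ov i si≤2k with odd (p + i) in oi
... | false = λ eq → tm-pair (p + i) oi (trans eq (cong tm (+-suc p i)))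
... | true with i <? k
...   | yes i<k = λ eq → tm-pair (p + k + i) even-pk+i (begin
        tm (p + k + i)          ≡⟨ ov i (<⇒≤ i<k) ⟨
        tm (p + i)              ≡⟨ eq ⟩
        tm (p + suc i)          ≡⟨ ov (suc i) i<k ⟩
        tm (p + k + suc i)      ≡⟨ cong tm (+-suc (p + k) i) ⟩
        tm (suc (p + k + i))    ∎)
  where
  even-pk+i : odd (p + k + i) ≡ false
  even-pk+i = begin
    odd (p + k + i)        ≡⟨ cong odd (trans (+-assoc p k i) (trans (cong (p +_) (+-comm k i)) (sym (+-assoc p i k)))) ⟩
    odd (p + i + k)        ≡⟨ odd-+-odd (p + i) k ok ⟩
    not (odd (p + i))      ≡⟨ cong not oi ⟩
    false                  ∎
...   | no i≮k = λ eq → tm-pair (p + j) even-p+j (begin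
        tm (p + j)              ≡⟨ ov j (<⇒≤ j<k) ⟩
        tm (p + k + j)          ≡⟨ cong tm k+j ⟩
        tm (p + i)              ≡⟨ eq ⟩
        tm (p + suc i)          ≡⟨ cong tm (trans (+-suc (p + k) j) (trans (cong suc k+j) (sym (+-suc p i)))) ⟨
        tm (p + k + suc j)      ≡⟨ ov (suc j) j<k ⟨
        tm (p + suc j)          ≡⟨ cong tm (+-suc p j) ⟩
        tm (suc (p + j))        ∎)
  where
  k≤i : k ≤ i
  k≤i = ≮⇒≥ i≮k
  j = i ∸ k
  j<k : j < k
  j<k = +-cancelˡ-< k j k (subst (λ z → suc z ≤ k + k) (sym (m+[n∸m]≡n k≤i)) si≤2k)
  k+j : p + k + j ≡ p + i
  k+j = trans (+-assoc p k j) (cong (p +_) (m+[n∸m]≡n k≤i))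
  even-p+j : odd (p + j) ≡ false
  even-p+j = not-injective (begin
    not (odd (p + j))   ≡⟨ odd-+-odd (p + j) k ok ⟨
    odd (p + j + k)     ≡⟨ cong odd (trans (+-assoc p j k) (trans (cong (p +_) (+-comm j k)) (sym (+-assoc p k j)))) ⟩
    odd (p + k + j)     ≡⟨ cong odd k+j ⟩
    odd (p + i)         ≡⟨ oi ⟩
    true                ∎)

overlap-odd→2 : ∀ p k → odd k ≡ true → 2 ≤ k → Overlap p k → Overlap p 2
overlap-odd→2 p k ok 2≤k ov i i≤2 = begin
  tm (p + i)            ≡⟨ (¬-not (alt i (≤-trans (s≤s (≤-trans i≤2 (n≤1+n 2))) 4≤2k))) ⟩
  not (tm (p + suc i))  ≡⟨ sym (¬-not (λ e → alt (suc i) (≤-trans (s≤s (s≤s i≤2)) 4≤2k) (sym e))) ⟩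
  tm (p + suc (suc i))  ≡⟨ cong tm (sym (+-assoc p 2 i)) ⟩
  tm (p + 2 + i)        ∎
  where
  alt = overlap-odd-alternates p k ok ov
  4≤2k : 4 ≤ k + k
  4≤2k = +-mono-≤ 2≤k 2≤k

-- Thue: the Thue–Morse sequence is overlap-free.  Strong induction on the
-- period: even periods halve, period 1 is excluded directly, odd periods
-- k ≥ 3 contain an overlap of period 2.
overlap-free : ∀ k → 1 ≤ k → ∀ p → ¬ Overlap p k
overlap-free = <-rec (λ k → 1 ≤ k → ∀ p → ¬ Overlap p k) step
  where
  step : ∀ k → (∀ {j} → j < k → 1 ≤ j → ∀ p → ¬ Overlap p j) → 1 ≤ k → ∀ p → ¬ Overlap p k
  step k rec 1≤k p ov with halving k
  ... | twice zero with () ← 1≤k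
  ... | twice (suc h) = let (q , ovq) = overlap-halve p (suc h) ov in
        rec (s≤s (s≤s (dbl≥ h))) (s≤s z≤n) q ovq
    where
    dbl≥ : ∀ n → n ≤ dbl n
    dbl≥ zero = z≤n
    dbl≥ (suc n) = s≤s (≤-trans (dbl≥ n) (n≤1+n _))
  ... | twice+1 zero = overlap-1 p ov
  ... | twice+1 (suc h) = rec {2} (s≤s (s≤s (s≤s z≤n))) (s≤s z≤n) p
        (overlap-odd→2 p (suc (dbl (suc h))) (odd-dbl+1 (suc h)) (s≤s (s≤s z≤n)) ov)

no-cube : ∀ p → tm p ≡ tm (suc p) → tm (suc p) ≢ tm (suc (suc p))
no-cube p e e' = overlap-free 1 ≤-refl p λ where
  zero _ → trans (cong tm (+-identityʳ p)) (trans e (cong tm (sym (trans (+-identityʳ (p + 1)) (+-comm p 1)))))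
  (suc zero) _ → trans (cong tm (+-comm p 1)) (trans e' (cong tm (sym (trans (+-assoc p 1 1) (+-comm p 2)))))
  (suc (suc _)) (s≤s ())

SquareAt : ∀ {A : Set} → (ℕ → A) → ℕ → ℕ → Set
SquareAt f u ℓ = ∀ j → j < ℓ → f (u + j) ≡ f (u + ℓ + j)

square-transport : ∀ {A : Set} (f g : ℕ → A) {u} v ℓ →
  (∀ j → j < ℓ + ℓ → f (u + j) ≡ g (v + j)) → SquareAt f u ℓ → SquareAt g v ℓ
square-transport f g {u} v ℓ same sq j j<ℓ = begin
  g (v + j)          ≡⟨ same j (≤-trans j<ℓ (m≤m+n ℓ ℓ)) ⟨
  f (u + j)          ≡⟨ sq j j<ℓ ⟩
  f (u + ℓ + j)      ≡⟨ cong f (+-assoc u ℓ j) ⟩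
  f (u + (ℓ + j))    ≡⟨ same (ℓ + j) (+-monoʳ-< ℓ j<ℓ) ⟩
  g (v + (ℓ + j))    ≡⟨ cong g (+-assoc v ℓ j) ⟨
  g (v + ℓ + j)      ∎

-- A square-free word over three colours (the "vtm" word): position n is
-- coloured by the pair (tm n , tm (n+1)), identifying the two equal pairs.

-- the four colours; cB is reserved for the marker of the boundary word and
-- for ring-1 vertices of odd parity
Colour : Set
Colour = Fin 4

cA cB cC cD : Colour
cA = 0F
cB = sF 0F
cC = sF (sF 0F)
cD = sF (sF (sF 0F))

pairColour : Bool → Bool → Colour
pairColour false false = cA
pairColour true true = cA
pairColour true false = cC
pairColour false true = cD

pairColour-cancelˡ : ∀ a {b c} → pairColour a b ≡ pairColour a c → b ≡ c
pairColour-cancelˡ false {false} {false} _ = refl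
pairColour-cancelˡ false {true} {true} _ = refl
pairColour-cancelˡ true {false} {false} _ = refl
pairColour-cancelˡ true {true} {true} _ = refl

pairColour-cancelʳ : ∀ {a b} c → pairColour a c ≡ pairColour b c → a ≡ b
pairColour-cancelʳ {false} {false} _ _ = refl
pairColour-cancelʳ {true} {true} _ _ = refl
pairColour-cancelʳ {false} {true} false ()
pairColour-cancelʳ {false} {true} true ()
pairColour-cancelʳ {true} {false} false ()
pairColour-cancelʳ {true} {false} true ()

pairColour-change : ∀ {a b c d} → a ≢ b → pairColour a b ≡ pairColour c d → a ≡ c
pairColour-change {false} {false} a≢b _ = contradiction refl a≢b
pairColour-change {true} {true} a≢b _ = contradiction refl a≢b
pairColour-change {false} {true} {false} {true} _ _ = refl
pairColour-change {false} {true} {false} {false} _ ()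
pairColour-change {false} {true} {true} {true} _ ()
pairColour-change {false} {true} {true} {false} _ ()
pairColour-change {true} {false} {true} {false} _ _ = refl
pairColour-change {true} {false} {true} {true} _ ()
pairColour-change {true} {false} {false} {false} _ ()
pairColour-change {true} {false} {false} {true} _ ()

pairColour-A : ∀ {a b} → pairColour a b ≡ cA → a ≡ b
pairColour-A {false} {false} _ = refl
pairColour-A {true} {true} _ = refl

vtm : ℕ → Colour
vtm n = pairColour (tm n) (tm (suc n))

vtm-notB : ∀ n → vtm n ≢ cB
vtm-notB n with tm n | tm (suc n)
... | false | false = λ ()
... | false | true = λ ()
... | true | false = λ ()
... | true | true = λ ()

-- aligned pairs differ, so cA only occurs at odd positions
vtm-even-notA : ∀ q → vtm (dbl q) ≢ cA
vtm-even-notA q e = tm-pair (dbl q) (odd-dbl q) (pairColour-A e)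

-- no factor x cA x: around an equal pair v v the neighbours are ¬v
vtm-noPalindrome : ∀ j → vtm (suc j) ≡ cA → vtm j ≢ vtm (suc (suc j))
vtm-noPalindrome j eA eq = distinct (tm (suc j)) (begin
  pairColour (not v) v                       ≡⟨ cong (λ z → pairColour z v) (¬-not left) ⟨
  vtm j                                      ≡⟨ eq ⟩
  pairColour (tm (suc (suc j))) (tm (suc (suc (suc j))))
                                             ≡⟨ cong₂ pairColour (sym mid) (¬-not right) ⟩
  pairColour v (not v)                       ∎)
  where
  v = tm (suc j)
  mid : v ≡ tm (suc (suc j))
  mid = pairColour-A eA
  left : tm j ≢ v
  left e = no-cube j e mid
  right : tm (suc (suc (suc j))) ≢ v
  right e = no-cube (suc j) mid (trans (sym mid) (sym e))
  distinct : ∀ b → pairColour (not b) b ≢ pairColour b (not b)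
  distinct false ()
  distinct true ()

-- a square in vtm propagates the equalities tm (u+i) = tm (u+ℓ+i) along
-- the whole window, producing an overlap of period ℓ
vtm-squarefree : ∀ u ℓ → 1 ≤ ℓ → ¬ SquareAt vtm u ℓ
vtm-squarefree u ℓ 1≤ℓ sq = overlap-free ℓ 1≤ℓ u (λ i i≤ℓ → spread i i≤ℓ (agree-0 start))
  where
  Agree : ℕ → Set
  Agree i = tm (u + i) ≡ tm (u + ℓ + i)
  sq' : ∀ j → j < ℓ → pairColour (tm (u + j)) (tm (u + suc j)) ≡ pairColour (tm (u + ℓ + j)) (tm (u + ℓ + suc j))
  sq' j j<ℓ rewrite +-suc u j | +-suc (u + ℓ) j = sq j j<ℓ
  agree-up : ∀ j → j < ℓ → Agree j → Agree (suc j)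
  agree-up j j<ℓ a = pairColour-cancelˡ (tm (u + ℓ + j))
    (trans (cong (λ z → pairColour z (tm (u + suc j))) (sym a)) (sq' j j<ℓ))
  agree-down : ∀ j → j < ℓ → Agree (suc j) → Agree j
  agree-down j j<ℓ a = pairColour-cancelʳ (tm (u + suc j))
    (trans (sq' j j<ℓ) (cong (pairColour (tm (u + ℓ + j))) (sym a)))
  at-change : ∀ j → j < ℓ → tm (u + j) ≢ tm (u + suc j) → Agree j
  at-change j j<ℓ ne = pairColour-change ne (sq' j j<ℓ)
  -- some position agrees: a change of tm at 0 or at 1, or ℓ = 1
  start : ∃[ j ] j ≤ ℓ × Agree j
  start with tm (u + 0) Bool.≟ tm (u + 1)
  ... | no ne = 0 , z≤n , at-change 0 1≤ℓ ne
  ... | yes e with ℓ ≟ 1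
  ...   | yes ℓ≡1 = 0 , z≤n , trans e (cong tm (trans (cong (u +_) (sym ℓ≡1)) (sym (+-identityʳ (u + ℓ)))))
  ...   | no ℓ≢1 = 1 , 1≤ℓ , at-change 1 (≤∧≢⇒< 1≤ℓ (ℓ≢1 ∘ sym)) (λ e' → no-cube u
          (trans (cong tm (sym (+-identityʳ u))) (trans e (cong tm (+-comm u 1))))
          (trans (cong tm (+-comm 1 u)) (trans e' (cong tm (+-comm u 2)))))
  agree-0 : ∃[ j ] j ≤ ℓ × Agree j → Agree 0
  agree-0 (j , j≤ℓ , a) = down j j≤ℓ a
    where
    down : ∀ j → j ≤ ℓ → Agree j → Agree 0
    down zero _ a = a
    down (suc j) sj≤ℓ a = down j (<⇒≤ sj≤ℓ) (agree-down j sj≤ℓ a)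
  spread : ∀ i → i ≤ ℓ → Agree 0 → Agree i
  spread zero _ a = a
  spread (suc i) si≤ℓ a = agree-up i si≤ℓ (spread i (<⇒≤ si≤ℓ) a)

-- The boundary word: a marker cB followed by a factor of vtm.  Read
-- cyclically with period N ≥ 2ℓ it has no square of period ℓ, because the
-- marker can only be matched with itself.

W : ℕ → Colour
W zero = cB
W (suc p) = vtm (suc (suc p))

W-notB : ∀ p → 1 ≤ p → W p ≢ cB
W-notB (suc p) _ = vtm-notB (suc (suc p))

W-odd-notA : ∀ p → odd p ≡ true → W p ≢ cA
W-odd-notA p op with halving p
... | twice q with () ← trans (sym (odd-dbl q)) op
... | twice+1 q = vtm-even-notA (suc q)

W-adjacent : ∀ p → 1 ≤ p → W p ≢ W (suc p)
W-adjacent (suc p) _ e = vtm-squarefree (suc (suc p)) 1 ≤-refl λ where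
  zero _ → trans (cong vtm (+-identityʳ (suc (suc p)))) (trans e (cong vtm (sym (trans (+-identityʳ (suc (suc p) + 1)) (+-comm (suc (suc p)) 1)))))
  (suc _) (s≤s ())

W-noPalindrome : ∀ r → 1 ≤ r → W (suc r) ≡ cA → W r ≢ W (suc (suc r))
W-noPalindrome (suc r) _ = vtm-noPalindrome (suc (suc r))

Wcyc : ℕ → ℕ → Colour
Wcyc N i with i <? N
... | yes _ = W i
... | no _ = W (i ∸ N)

Wcyc-lo : ∀ N i → i < N → Wcyc N i ≡ W i
Wcyc-lo N i i<N with i <? N
... | yes _ = refl
... | no i≮N = contradiction i<N i≮N

Wcyc-hi : ∀ N i → N ≤ i → Wcyc N i ≡ W (i ∸ N)
Wcyc-hi N i N≤i with i <? N
... | yes i<N = contradiction N≤i (<⇒≱ i<N)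
... | no _ = refl

Wcyc-B : ∀ N i → Wcyc N i ≡ cB → i ≡ 0 ⊎ i ≡ N
Wcyc-B N i e with i <? N
Wcyc-B N zero e | yes _ = inj₁ refl
Wcyc-B N (suc i) e | yes _ = contradiction e (W-notB (suc i) (s≤s z≤n))
... | no i≮N with i ∸ N in d
...   | zero = inj₂ (≤-antisym (m∸n≡0⇒m≤n d) (≮⇒≥ i≮N))
...   | suc d' = contradiction e (W-notB (suc d') (s≤s z≤n))

marker-gap : ∀ N i ℓ → 1 ≤ ℓ → ℓ < N → Wcyc N i ≡ cB → Wcyc N (i + ℓ) ≢ cB
marker-gap N i ℓ 1≤ℓ ℓ<N eB eB' with Wcyc-B N i eB | Wcyc-B N (i + ℓ) eB'
... | inj₁ refl | inj₁ e = <⇒≢ 1≤ℓ (sym e)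
... | inj₁ refl | inj₂ e = <⇒≢ ℓ<N e
... | inj₂ refl | inj₁ e = <⇒≢ (≤-trans 1≤ℓ (m≤n+m ℓ N)) (sym e)
... | inj₂ refl | inj₂ e = <⇒≢ 1≤ℓ (sym (+-cancelˡ-≡ N ℓ 0 (trans e (sym (+-identityʳ N)))))

W-pos : ∀ p → 1 ≤ p → W p ≡ vtm (suc p)
W-pos (suc p) _ = refl

-- a marker inside the window of a square would be matched with a second
-- marker at distance ℓ
no-marker-in-square : ∀ N u ℓ → 1 ≤ ℓ → ℓ < N → SquareAt (Wcyc N) u ℓ →
  ∀ j → j < ℓ + ℓ → Wcyc N (u + j) ≢ cB
no-marker-in-square N u ℓ 1≤ℓ ℓ<N sq j j<2ℓ eB with j <? ℓ
... | yes j<ℓ = marker-gap N (u + j) ℓ 1≤ℓ ℓ<N eB (begin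
      Wcyc N (u + j + ℓ)  ≡⟨ cong (Wcyc N) (trans (+-assoc u j ℓ) (trans (cong (u +_) (+-comm j ℓ)) (sym (+-assoc u ℓ j)))) ⟩
      Wcyc N (u + ℓ + j)  ≡⟨ sq j j<ℓ ⟨
      Wcyc N (u + j)      ≡⟨ eB ⟩
      cB                  ∎)
... | no j≮ℓ = marker-gap N (u + i) ℓ 1≤ℓ ℓ<N (trans (sq i i<ℓ) (trans (cong (Wcyc N) u+ℓ+i) eB)) (trans (cong (Wcyc N) u+i+ℓ) eB)
  where
  i = j ∸ ℓ
  i+ℓ : i + ℓ ≡ j
  i+ℓ = m∸n+n≡m (≮⇒≥ j≮ℓ)
  i<ℓ : i < ℓ
  i<ℓ = +-cancelʳ-< ℓ i ℓ (subst (_< ℓ + ℓ) (sym i+ℓ) j<2ℓ)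
  u+i+ℓ : u + i + ℓ ≡ u + j
  u+i+ℓ = trans (+-assoc u i ℓ) (cong (u +_) i+ℓ)
  u+ℓ+i : u + ℓ + i ≡ u + j
  u+ℓ+i = trans (+-assoc u ℓ i) (cong (u +_) (trans (+-comm ℓ i) i+ℓ))

-- The doubled word has no square of period ℓ ≤ N/2: a window meeting
-- position 0 or N contains a marker, and a window avoiding them lies
-- inside one copy of the square-free word vtm.
cyclic-squarefree : ∀ N u ℓ → 1 ≤ ℓ → ℓ + ℓ ≤ N → ¬ SquareAt (Wcyc N) u ℓ
cyclic-squarefree N u ℓ 1≤ℓ 2ℓ≤N sq = by-position
  where
  no-marker : ∀ j → j < ℓ + ℓ → Wcyc N (u + j) ≢ cB
  no-marker = no-marker-in-square N u ℓ 1≤ℓ (<-≤-trans (m<m+n ℓ 1≤ℓ) 2ℓ≤N) sq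
  0<2ℓ : 0 < ℓ + ℓ
  0<2ℓ = ≤-trans 1≤ℓ (m≤m+n ℓ ℓ)
  marker-N : Wcyc N N ≡ cB
  marker-N = trans (Wcyc-hi N N ≤-refl) (cong W (n∸n≡0 N))
  by-position : ⊥
  by-position with <-cmp u N
  ... | tri≈ _ u≡N _ = no-marker 0 0<2ℓ (trans (cong (Wcyc N) (trans (+-identityʳ u) u≡N)) marker-N)
  ... | tri> _ _ N<u = vtm-squarefree (suc s) ℓ 1≤ℓ (square-transport (Wcyc N) vtm (suc s) ℓ in-second-copy sq)
    where
    s = u ∸ N
    in-second-copy : ∀ j → j < ℓ + ℓ → Wcyc N (u + j) ≡ vtm (suc s + j)
    in-second-copy j _ = begin
      Wcyc N (u + j)    ≡⟨ Wcyc-hi N (u + j) (≤-trans (<⇒≤ N<u) (m≤m+n u j)) ⟩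
      W (u + j ∸ N)     ≡⟨ cong W (+-∸-comm j (<⇒≤ N<u)) ⟩
      W (s + j)         ≡⟨ W-pos (s + j) (≤-trans (m<n⇒0<n∸m N<u) (m≤m+n s j)) ⟩
      vtm (suc s + j)   ∎
  ... | tri< u<N _ _ with u ≟ 0
  ...   | yes u≡0 = no-marker 0 0<2ℓ (trans (Wcyc-lo N (u + 0) (subst (_< N) (sym (+-identityʳ u)) u<N)) (cong W (trans (+-identityʳ u) u≡0)))
  ...   | no u≢0 with u + (ℓ + ℓ) ≤? N
  ...     | yes fits = vtm-squarefree (suc u) ℓ 1≤ℓ (square-transport (Wcyc N) vtm (suc u) ℓ in-first-copy sq)
    where
    in-first-copy : ∀ j → j < ℓ + ℓ → Wcyc N (u + j) ≡ vtm (suc u + j)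
    in-first-copy j j<2ℓ = trans (Wcyc-lo N (u + j) (<-≤-trans (+-monoʳ-< u j<2ℓ) fits))
                                 (W-pos (u + j) (≤-trans (n≢0⇒n>0 u≢0) (m≤m+n u j)))
  ...     | no over = no-marker (N ∸ u) N∸u<2ℓ (trans (cong (Wcyc N) (m+[n∸m]≡n (<⇒≤ u<N))) marker-N)
    where
    N∸u<2ℓ : N ∸ u < ℓ + ℓ
    N∸u<2ℓ = +-cancelˡ-< u (N ∸ u) (ℓ + ℓ) (subst (_< u + (ℓ + ℓ)) (sym (m+[n∸m]≡n (<⇒≤ u<N))) (≰⇒> over))

at : ∀ {A : Set} → List A → ℕ → Maybe A
at [] _ = nothing
at (x ∷ xs) zero = just x
at (x ∷ xs) (suc n) = at xs n

at-++ˡ : ∀ {A : Set} (xs ys : List A) i → i < length xs → at (xs ++ ys) i ≡ at xs i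
at-++ˡ (x ∷ xs) ys zero _ = refl
at-++ˡ (x ∷ xs) ys (suc i) (s≤s i<) = at-++ˡ xs ys i i<

at-++ʳ : ∀ {A : Set} (xs ys : List A) i → at (xs ++ ys) (length xs + i) ≡ at ys i
at-++ʳ [] ys i = refl
at-++ʳ (x ∷ xs) ys i = at-++ʳ xs ys i

at-take : ∀ {A : Set} k (xs : List A) i → i < k → at (take k xs) i ≡ at xs i
at-take (suc k) [] i _ = refl
at-take (suc k) (x ∷ xs) zero _ = refl
at-take (suc k) (x ∷ xs) (suc i) (s≤s i<k) = at-take k xs i i<k

at-drop : ∀ {A : Set} s (xs : List A) i → at (drop s xs) i ≡ at xs (s + i)
at-drop zero xs i = refl
at-drop (suc s) [] i = refl
at-drop (suc s) (x ∷ xs) i = at-drop s xs i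

at-map : ∀ {A B : Set} (f : A → B) (xs : List A) i → at (map f xs) i ≡ Maybe.map f (at xs i)
at-map f [] i = refl
at-map f (x ∷ xs) zero = refl
at-map f (x ∷ xs) (suc i) = at-map f xs i

at-applyUpTo : ∀ {A : Set} (h : ℕ → A) n q → q < n → at (applyUpTo h n) q ≡ just (h q)
at-applyUpTo h (suc n) zero _ = refl
at-applyUpTo h (suc n) (suc q) (s≤s q<n) = at-applyUpTo (h ∘ suc) n q q<n

length-take≤ : ∀ {A : Set} k (xs : List A) → length (take k xs) ≤ k
length-take≤ k xs = ≤-trans (≤-reflexive (length-take k xs)) (m⊓n≤m k (length xs))

nonrep-by-index : ∀ {A : Set} (xs : List A) (f : ℕ → A) →
  (∀ i → i < length xs → at xs i ≡ just (f i)) →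
  (∀ u ℓ → 1 ≤ ℓ → u + (ℓ + ℓ) ≤ length xs → ¬ SquareAt f u ℓ) →
  Nonrepetitive xs
nonrep-by-index xs f read no-square as bs cs refl (ys , 1≤ℓ , refl) =
  no-square u ℓ 1≤ℓ fits λ j j<ℓ → just-injective (begin
    just (f (u + j))        ≡⟨ read (u + j) (<-≤-trans (+-monoʳ-< u (≤-trans j<ℓ (m≤m+n ℓ ℓ))) fits) ⟨
    at xs (u + j)           ≡⟨ at-++ʳ as _ j ⟩
    at ((ys ++ ys) ++ cs) j ≡⟨ at-++ˡ (ys ++ ys) cs j (subst (j <_) (sym (length-++ ys)) (≤-trans j<ℓ (m≤m+n ℓ ℓ))) ⟩
    at (ys ++ ys) j         ≡⟨ at-++ˡ ys ys j j<ℓ ⟩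
    at ys j                 ≡⟨ at-++ʳ ys ys j ⟨
    at (ys ++ ys) (ℓ + j)   ≡⟨ at-++ˡ (ys ++ ys) cs (ℓ + j) (subst (ℓ + j <_) (sym (length-++ ys)) (+-monoʳ-< ℓ j<ℓ)) ⟨
    at ((ys ++ ys) ++ cs) (ℓ + j) ≡⟨ at-++ʳ as _ (ℓ + j) ⟨
    at xs (u + (ℓ + j))     ≡⟨ read (u + (ℓ + j)) (<-≤-trans (+-monoʳ-< u (+-monoʳ-< ℓ j<ℓ)) fits) ⟩
    just (f (u + (ℓ + j)))  ≡⟨ cong (just ∘ f) (+-assoc u ℓ j) ⟨
    just (f (u + ℓ + j))    ∎)
  where
  u = length as
  ℓ = length ys
  fits : u + (ℓ + ℓ) ≤ length xs
  fits = ≤-trans (m≤m+n (u + (ℓ + ℓ)) (length cs)) (≤-reflexive (begin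
    u + (ℓ + ℓ) + length cs             ≡⟨ +-assoc u (ℓ + ℓ) (length cs) ⟩
    u + ((ℓ + ℓ) + length cs)           ≡⟨ cong (λ z → u + (z + length cs)) (length-++ ys) ⟨
    u + (length (ys ++ ys) + length cs) ≡⟨ cong (u +_) (length-++ (ys ++ ys)) ⟨
    u + length ((ys ++ ys) ++ cs)       ≡⟨ length-++ as ⟨
    length xs                           ∎))

nonrep-reverse : ∀ {A : Set} (zs : List A) → Nonrepetitive zs → Nonrepetitive (reverse zs)
nonrep-reverse zs nr as bs cs e (ys , 1≤ℓ , refl) =
  nr (reverse cs) (reverse ys ++ reverse ys) (reverse as) zs-split
     (reverse ys , subst (1 ≤_) (sym (length-reverse ys)) 1≤ℓ , refl)
  where
  zs-split : zs ≡ reverse cs ++ (reverse ys ++ reverse ys) ++ reverse as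
  zs-split = begin
    zs                                              ≡⟨ reverse-involutive zs ⟨
    reverse (reverse zs)                            ≡⟨ cong reverse e ⟩
    reverse (as ++ (ys ++ ys) ++ cs)                ≡⟨ reverse-++ as _ ⟩
    reverse ((ys ++ ys) ++ cs) ++ reverse as        ≡⟨ cong (_++ reverse as) (reverse-++ (ys ++ ys) cs) ⟩
    (reverse cs ++ reverse (ys ++ ys)) ++ reverse as ≡⟨ ++-assoc (reverse cs) _ (reverse as) ⟩
    reverse cs ++ reverse (ys ++ ys) ++ reverse as  ≡⟨ cong (λ z → reverse cs ++ z ++ reverse as) (reverse-++ ys ys) ⟩
    reverse cs ++ (reverse ys ++ reverse ys) ++ reverse as ∎

-- A facial path is a window of length ≤ |B| in the doubled
-- boundary B ++ B, read forwards or backwards.  So a face is fine as soon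
-- as the colours g of B ++ B have no square of period ≤ |B|/2.

facial-nonrep : ∀ {V C : Set} (B : List V) (c : V → C) (g : ℕ → C) →
  (∀ i → i < length B + length B → at (map c (B ++ B)) i ≡ just (g i)) →
  (∀ u ℓ → 1 ≤ ℓ → ℓ + ℓ ≤ length B → u + (ℓ + ℓ) ≤ length B + length B → ¬ SquareAt g u ℓ) →
  ∀ P → FacialPathOf B P → Nonrepetitive (map c P)
facial-nonrep B c g read no-square P (s , k , s<B , 1≤k , k≤B , inj₂ refl) =
  subst Nonrepetitive (sym (reverse-map c (take k (drop s (B ++ B)))))
    (nonrep-reverse _ (facial-nonrep B c g read no-square _ (s , k , s<B , 1≤k , k≤B , inj₁ refl)))
facial-nonrep B c g read no-square P (s , k , s<B , _ , k≤B , inj₁ refl) =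
  subst Nonrepetitive window-map (nonrep-by-index window (g ∘ (s +_)) read-window no-square-window)
  where
  L = map c (B ++ B)
  window = take k (drop s L)
  window-map : window ≡ map c (take k (drop s (B ++ B)))
  window-map = trans (cong (take k) (drop-map {f = c} s (B ++ B))) (take-map {f = c} k (drop s (B ++ B)))
  read-window : ∀ i → i < length window → at window i ≡ just (g (s + i))
  read-window i i<w = begin
    at window i     ≡⟨ at-take k (drop s L) i i<k ⟩
    at (drop s L) i ≡⟨ at-drop s L i ⟩
    at L (s + i)    ≡⟨ read (s + i) (+-mono-<-≤ s<B (≤-trans (<⇒≤ i<k) k≤B)) ⟩
    just (g (s + i)) ∎
    where
    i<k : i < k
    i<k = <-≤-trans i<w (length-take≤ k (drop s L))
  no-square-window : ∀ u ℓ → 1 ≤ ℓ → u + (ℓ + ℓ) ≤ length window → ¬ SquareAt (g ∘ (s +_)) u ℓ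
  no-square-window u ℓ 1≤ℓ fits sq =
    no-square (s + u) ℓ 1≤ℓ (≤-trans (m≤n+m (ℓ + ℓ) u) fits′) in-doubled
      (square-transport (g ∘ (s +_)) g (s + u) ℓ (λ j _ → cong g (sym (+-assoc s u j))) sq)
    where
    fits′ : u + (ℓ + ℓ) ≤ length B
    fits′ = ≤-trans (≤-trans fits (length-take≤ k (drop s L))) k≤B
    in-doubled : s + u + (ℓ + ℓ) ≤ length B + length B
    in-doubled = subst (_≤ length B + length B) (sym (+-assoc s u (ℓ + ℓ))) (+-mono-≤ (<⇒≤ s<B) fits′)

-- A 4-cycle coloured a b c d (in cyclic order) is good when
-- consecutive colours differ and the diagonals are not both monochromatic;
-- these are exactly the repetitions of length 2 and 4 along it.

GoodSquare : ∀ {C : Set} → C → C → C → C → Set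
GoodSquare a b c d = (a ≢ b) × (b ≢ c) × (c ≢ d) × (d ≢ a) × ¬ ((a ≡ c) × (b ≡ d))

rotate : ∀ {C : Set} {a b c d : C} → GoodSquare a b c d → GoodSquare b c d a
rotate (ab , bc , cd , da , diag) = bc , cd , da , ab , λ (bd , ca) → diag (sym ca , bd)

rotate² : ∀ {C : Set} {a b c d : C} → GoodSquare a b c d → GoodSquare c d a b
rotate² = rotate ∘ rotate

rotate³ : ∀ {C : Set} {a b c d : C} → GoodSquare a b c d → GoodSquare d a b c
rotate³ = rotate ∘ rotate²

good-resp : ∀ {C : Set} {a b c d a′ b′ c′ d′ : C} →
  a ≡ a′ → b ≡ b′ → c ≡ c′ → d ≡ d′ → GoodSquare a′ b′ c′ d′ → GoodSquare a b c d
good-resp refl refl refl refl g = g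

cycle4 : ∀ {C : Set} → C → C → C → C → ℕ → C
cycle4 a b c d 0 = a
cycle4 a b c d 1 = b
cycle4 a b c d 2 = c
cycle4 a b c d 3 = d
cycle4 a b c d (suc (suc (suc (suc n)))) = cycle4 a b c d n

cycle4-squarefree : ∀ {C : Set} {a b c d : C} → GoodSquare a b c d →
  ∀ u ℓ → 1 ≤ ℓ → ℓ + ℓ ≤ 4 → ¬ SquareAt (cycle4 a b c d) u ℓ
cycle4-squarefree good u 1 _ _ sq = adjacent u (trans (cong (cycle4 _ _ _ _) (sym (+-identityʳ u))) (trans (sq 0 ≤-refl) (cong (cycle4 _ _ _ _) (trans (+-identityʳ (u + 1)) (+-comm u 1)))))
  where
  adjacent : ∀ u → cycle4 _ _ _ _ u ≢ cycle4 _ _ _ _ (suc u)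
  adjacent 0 = proj₁ good
  adjacent 1 = proj₁ (proj₂ good)
  adjacent 2 = proj₁ (proj₂ (proj₂ good))
  adjacent 3 = proj₁ (proj₂ (proj₂ (proj₂ good)))
  adjacent (suc (suc (suc (suc u)))) = adjacent u
cycle4-squarefree {a = a} {b} {c} {d} good u 2 _ _ sq = diagonals u (sq 0 (s≤s z≤n)) (sq 1 ≤-refl)
  where
  diag = proj₂ (proj₂ (proj₂ (proj₂ good)))
  diagonals : ∀ u → cycle4 a b c d (u + 0) ≡ cycle4 a b c d (u + 2 + 0) →
                    cycle4 a b c d (u + 1) ≡ cycle4 a b c d (u + 2 + 1) → ⊥
  diagonals 0 e₁ e₂ = diag (e₁ , e₂)
  diagonals 1 e₁ e₂ = diag (sym e₂ , e₁)
  diagonals 2 e₁ e₂ = diag (sym e₁ , sym e₂)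
  diagonals 3 e₁ e₂ = diag (e₂ , sym e₁)
  diagonals (suc (suc (suc (suc u)))) = diagonals u
cycle4-squarefree good u (suc (suc (suc ℓ))) _ (s≤s (s≤s (s≤s 2ℓ≤4))) _ =
  <⇒≱ (≤-trans (s≤s (s≤s z≤n)) (m≤n+m (suc (suc (suc ℓ))) ℓ)) 2ℓ≤4

square-face-nonrep : ∀ {C : Set} (c : ℕ × ℕ → C) i j →
  GoodSquare (c (i , j)) (c (suc i , j)) (c (suc i , suc j)) (c (i , suc j)) →
  ∀ P → FacialPathOf (squareFace i j) P → Nonrepetitive (map c P)
square-face-nonrep c i j good = facial-nonrep (squareFace i j) c (cycle4 _ _ _ _) read
  (λ u ℓ 1≤ℓ 2ℓ≤4 _ → cycle4-squarefree good u ℓ 1≤ℓ 2ℓ≤4)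
  where
  read : ∀ u → u < 8 → at (map c (squareFace i j ++ squareFace i j)) u ≡ just (cycle4 _ _ _ _ u)
  read 0 _ = refl
  read 1 _ = refl
  read 2 _ = refl
  read 3 _ = refl
  read 4 _ = refl
  read 5 _ = refl
  read 6 _ = refl
  read 7 _ = refl
  read (suc (suc (suc (suc (suc (suc (suc (suc _)))))))) (s≤s (s≤s (s≤s (s≤s (s≤s (s≤s (s≤s (s≤s ()))))))))

-- The interior vertex (x, y) of the grid [0, m]²
-- lies on ring r = its distance to the boundary and gets a colour coding
-- the parities of r and of x + y.  Neighbours differ in the parity of
-- x + y; along one diagonal of each unit square the ring changes by one,
-- except on the central square of an odd grid.

ringColour : Bool → Bool → Colour
ringColour true false = cA
ringColour true true = cB
ringColour false false = cC
ringColour false true = cD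

decodeColour : Colour → Bool × Bool
decodeColour 0F = true , false
decodeColour (sF 0F) = true , true
decodeColour (sF (sF 0F)) = false , false
decodeColour (sF (sF (sF 0F))) = false , true

decode-ringColour : ∀ a b → decodeColour (ringColour a b) ≡ (a , b)
decode-ringColour true false = refl
decode-ringColour true true = refl
decode-ringColour false false = refl
decode-ringColour false true = refl

ringColour-injective : ∀ {a b a′ b′} → ringColour a b ≡ ringColour a′ b′ → (a ≡ a′) × (b ≡ b′)
ringColour-injective {a} {b} {a′} {b′} e with eq ← trans (sym (decode-ringColour a b)) (trans (cong decodeColour e) (decode-ringColour a′ b′)) =
  cong proj₁ eq , cong proj₂ eq

tent : ℕ → ℕ → ℕ
tent m t = t ⊓ (m ∸ t)

ring : ℕ → ℕ → ℕ → ℕ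
ring m x y = tent m x ⊓ tent m y

ringCol : ℕ → ℕ → ℕ → Colour
ringCol m x y = ringColour (odd (ring m x y)) (odd (x + y))

data Step : ℕ → ℕ → Set where
  up   : ∀ {a} → Step a (suc a)
  down : ∀ {a} → Step (suc a) a
  flat : ∀ {a} → Step a a

step-suc : ∀ {a b} → Step a b → Step (suc a) (suc b)
step-suc up = up
step-suc down = down
step-suc flat = flat

⊓-step : ∀ t d → Step (t ⊓ suc d) (suc t ⊓ d)
⊓-step zero zero = flat
⊓-step zero (suc d) = up
⊓-step (suc zero) zero = down
⊓-step (suc (suc t)) zero = down
⊓-step (suc t) (suc d) = step-suc (⊓-step t d)

⊓-flat : ∀ t d → t ⊓ suc d ≡ suc t ⊓ d → t ≡ d
⊓-flat zero zero _ = refl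
⊓-flat (suc t) (suc d) e = cong suc (⊓-flat t d (suc-injective e))

tent-step : ∀ m t → t < m → Step (tent m t) (tent m (suc t))
tent-step m t t<m with m ∸ t in e
... | zero = contradiction e (m>n⇒m∸n≢0 t<m)
... | suc d = subst (Step (t ⊓ suc d)) (cong (suc t ⊓_) (sym (trans (sym (pred[m∸n]≡m∸[1+n] m t)) (cong pred e)))) (⊓-step t d)

tent-flat : ∀ m t → t < m → tent m t ≡ tent m (suc t) → m ≡ suc (t + t)
tent-flat m t t<m flat-t = begin
  m                  ≡⟨ m+[n∸m]≡n (<⇒≤ t<m) ⟨
  t + (m ∸ t)        ≡⟨ cong (t +_) m∸t ⟩
  t + suc t          ≡⟨ +-suc t t ⟩
  suc (t + t)        ∎
  where
  m∸t : m ∸ t ≡ suc t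
  m∸t with m ∸ t in e
  ... | zero = contradiction e (m>n⇒m∸n≢0 t<m)
  ... | suc d = cong suc (sym (⊓-flat t d (begin
        t ⊓ suc d          ≡⟨ flat-t ⟩
        suc t ⊓ (m ∸ suc t) ≡⟨ cong (suc t ⊓_) (trans (sym (pred[m∸n]≡m∸[1+n] m t)) (cong pred e)) ⟩
        suc t ⊓ d          ∎)))

tent-double : ∀ m s → s ≤ m → tent m s + tent m s ≤ m
tent-double m s s≤m = ≤-trans (+-mono-≤ (m⊓n≤m s (m ∸ s)) (m⊓n≤n s (m ∸ s))) (≤-reflexive (m+[n∸m]≡n s≤m))

tent≤ : ∀ t s → tent (suc (t + t)) s ≤ t
tent≤ t s with s ≤? suc (t + t)
... | no s≰m = ≤-trans (m⊓n≤n s _) (≤-trans (≤-reflexive (m≤n⇒m∸n≡0 (<⇒≤ (≰⇒> s≰m)))) z≤n)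
... | yes s≤m = ≮⇒≥ λ t<tent → contradiction
      (subst (_≤ t + t) (+-suc t t) (≤-pred (≤-trans (+-mono-≤ t<tent t<tent) (tent-double _ s s≤m))))
      1+n≰n

OffByOne : ℕ → ℕ → Set
OffByOne a c = (c ≡ suc a) ⊎ (a ≡ suc c)

parity-differs : ∀ n → odd n ≢ odd (suc n)
parity-differs n e = not-¬ refl (trans e (odd-suc n))

offByOne-parity : ∀ {a c} → OffByOne a c → odd a ≢ odd c
offByOne-parity {a} (inj₁ refl) = parity-differs a
offByOne-parity {c = c} (inj₂ refl) e = parity-differs c (sym e)

-- The minimum of two tent steps: if the x-step a → a′ and the y-step
-- b → b′ are not both flat (and a flat step is a maximum), then one
-- diagonal of the square of minima changes by exactly one.
min-diagonal : ∀ {a a′ b b′} → Step a a′ → Step b b′ →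
  (a ≡ a′ → b ≤ a × b′ ≤ a) → (b ≡ b′ → a ≤ b × a′ ≤ b) → ¬ (a ≡ a′ × b ≡ b′) →
  OffByOne (a ⊓ b) (a′ ⊓ b′) ⊎ OffByOne (a′ ⊓ b) (a ⊓ b′)
min-diagonal up up _ _ _ = inj₁ (inj₁ refl)
min-diagonal down down _ _ _ = inj₁ (inj₂ refl)
min-diagonal up down _ _ _ = inj₂ (inj₂ refl)
min-diagonal down up _ _ _ = inj₂ (inj₁ refl)
min-diagonal {a} {b = b} flat up peak _ _ with (b≤a , sb≤a) ← peak refl =
  inj₁ (inj₁ (trans (m≥n⇒m⊓n≡n sb≤a) (cong suc (sym (m≥n⇒m⊓n≡n b≤a)))))
min-diagonal {a} {b′ = b′} flat down peak _ _ with (sb≤a , b≤a) ← peak refl =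
  inj₂ (inj₂ (trans (m≥n⇒m⊓n≡n sb≤a) (cong suc (sym (m≥n⇒m⊓n≡n b≤a)))))
min-diagonal {a} {b = b} up flat _ peak _ with (a≤b , sa≤b) ← peak refl =
  inj₁ (inj₁ (trans (m≤n⇒m⊓n≡m sa≤b) (cong suc (sym (m≤n⇒m⊓n≡m a≤b)))))
min-diagonal {a′ = a′} {b} down flat _ peak _ with (sa≤b , a≤b) ← peak refl =
  inj₂ (inj₁ (trans (m≤n⇒m⊓n≡m sa≤b) (cong suc (sym (m≤n⇒m⊓n≡m a≤b)))))
min-diagonal flat flat _ _ not-both = contradiction (refl , refl) not-both

tent-middle : ∀ t → tent (suc (t + t)) t ≡ t
tent-middle t = m≤n⇒m⊓n≡m (≤-trans (n≤1+n t) (≤-reflexive (sym (trans (cong (_∸ t) (sym (+-suc t t))) (m+n∸m≡n t (suc t))))))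

tent-peak : ∀ m t → t < m → tent m t ≡ tent m (suc t) → ∀ s → tent m s ≤ tent m t
tent-peak m t t<m flat-t s rewrite tent-flat m t t<m flat-t =
  subst (tent (suc (t + t)) s ≤_) (sym (tent-middle t)) (tent≤ t s)

dbl-injective : ∀ {x y} → x + x ≡ y + y → x ≡ y
dbl-injective {x} {y} e = begin
  x                  ≡⟨ halve-dbl x ⟨
  ⌊ dbl x /2⌋        ≡⟨ cong ⌊_/2⌋ (trans (dbl≡+ x) (trans e (sym (dbl≡+ y)))) ⟩
  ⌊ dbl y /2⌋        ≡⟨ halve-dbl y ⟩
  y                  ∎

ringCol-good : ∀ m x y → x < m → y < m → ¬ (m ≡ suc (x + x) × y ≡ x) →
  GoodSquare (ringCol m x y) (ringCol m (suc x) y) (ringCol m (suc x) (suc y)) (ringCol m x (suc y))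
ringCol-good m x y x<m y<m not-centre =
  (λ e → parity-differs (x + y) (vertex e)) ,
  (λ e → parity-differs (suc (x + y)) (trans (vertex e) (cong (odd ∘ suc) (+-suc x y)))) ,
  (λ e → parity-differs (x + y) (sym (trans (cong odd (sym (+-suc x y))) (trans (sym (vertex e)) (cong (odd ∘ suc) (+-suc x y)))))) ,
  (λ e → parity-differs (x + y) (sym (trans (cong odd (sym (+-suc x y))) (vertex e)))) ,
  diagonals
  where
  vertex : ∀ {r r′ s s′} → ringColour r s ≡ ringColour r′ s′ → s ≡ s′
  vertex e = proj₂ (ringColour-injective e)
  ringParity : ∀ {r r′ s s′} → ringColour r s ≡ ringColour r′ s′ → r ≡ r′
  ringParity e = proj₁ (ringColour-injective e)
  peak-x : tent m x ≡ tent m (suc x) → tent m y ≤ tent m x × tent m (suc y) ≤ tent m x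
  peak-x flat-x = tent-peak m x x<m flat-x y , tent-peak m x x<m flat-x (suc y)
  peak-y : tent m y ≡ tent m (suc y) → tent m x ≤ tent m y × tent m (suc x) ≤ tent m y
  peak-y flat-y = tent-peak m y y<m flat-y x , tent-peak m y y<m flat-y (suc x)
  not-both : ¬ (tent m x ≡ tent m (suc x) × tent m y ≡ tent m (suc y))
  not-both (flat-x , flat-y) = not-centre (mx , dbl-injective (suc-injective (trans (sym (tent-flat m y y<m flat-y)) mx)))
    where
    mx = tent-flat m x x<m flat-x
  diagonals : ¬ ((ringCol m x y ≡ ringCol m (suc x) (suc y)) × (ringCol m (suc x) y ≡ ringCol m x (suc y)))
  diagonals (e₁ , e₂) with min-diagonal (tent-step m x x<m) (tent-step m y y<m) peak-x peak-y not-both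
  ... | inj₁ off = offByOne-parity off (ringParity e₁)
  ... | inj₂ off = offByOne-parity off (ringParity e₂)

-- The vertices next to the boundary
-- form ring 1, coloured rim (x+y odd) ∈ {cA, cB}; the boundary vertex with
-- outer-face index p has x + y ≡ p (mod 2).  Since W avoids cB (except at
-- the marker) and avoids cA at odd positions, squares along a side and at
-- a corner are good.

rim : Bool → Colour
rim = ringColour true

-- a boundary edge p, p+1 together with its two ring-1 neighbours
side-good : ∀ p → 1 ≤ p → GoodSquare (W p) (W (suc p)) (rim (odd p)) (rim (not (odd p)))
side-good p 1≤p = by-parity (odd p) refl
  where
  by-parity : ∀ b → odd p ≡ b → GoodSquare (W p) (W (suc p)) (rim b) (rim (not b))
  by-parity true op = W-adjacent p 1≤p , W-notB (suc p) (s≤s z≤n) , (λ ()) ,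
                      (λ e → W-odd-notA p op (sym e)) , λ (e , _) → W-notB p 1≤p e
  by-parity false op = W-adjacent p 1≤p , W-odd-notA (suc p) (trans (odd-suc p) (cong not op)) , (λ ()) ,
                       (λ e → W-notB p 1≤p (sym e)) , λ (_ , e) → W-notB (suc p) (s≤s z≤n) e

-- a corner: three boundary vertices r, r+1, r+2 and the ring-1 vertex
-- diagonally opposite to r+1
corner-good : ∀ r → 1 ≤ r → GoodSquare (W r) (W (suc r)) (W (suc (suc r))) (rim (odd (suc r)))
corner-good r 1≤r = by-parity (odd (suc r)) refl
  where
  by-parity : ∀ b → odd (suc r) ≡ b → GoodSquare (W r) (W (suc r)) (W (suc (suc r))) (rim b)
  by-parity true _ = W-adjacent r 1≤r , W-adjacent (suc r) (s≤s z≤n) , W-notB (suc (suc r)) (s≤s z≤n) ,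
                     (λ e → W-notB r 1≤r (sym e)) , λ (_ , e) → W-notB (suc r) (s≤s z≤n) e
  by-parity false osr = W-adjacent r 1≤r , W-adjacent (suc r) (s≤s z≤n) , W-odd-notA (suc (suc r)) odd-r ,
                        (λ e → W-odd-notA r odd-r (sym e)) , λ (e , e′) → W-noPalindrome r 1≤r e′ e
    where
    odd-r : odd r ≡ true
    odd-r = not-injective (trans (sym (odd-suc r)) osr)

-- the corner at the origin, where the marker cB sits
origin-good : ∀ q → odd q ≡ true → GoodSquare cB (W 1) cA (W q)
origin-good q oq = (λ e → W-notB 1 ≤-refl (sym e)) , W-odd-notA 1 refl ,
  (λ e → W-odd-notA q oq (sym e)) , W-notB q (1≤q q oq) , λ (e , _) → contradiction e λ ()
  where
  1≤q : ∀ q → odd q ≡ true → 1 ≤ q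
  1≤q (suc _) _ = s≤s z≤n

row : Colour → Colour → Colour → Colour → ℕ → Colour
row a b c d 0 = a
row a b c d 1 = b
row a b c d 2 = c
row a b c d _ = d

-- patch for the square [k-1, k+2]² of the grid with m = 2k+1, in local
-- coordinates; the argument is the parity of the ring through the centre
patch : Bool → ℕ → ℕ → Colour
patch true x 0 = row cC cB cC cD x
patch true x 1 = row cB cA cB cA x
patch true x 2 = row cC cB cD cC x
patch true x _ = row cD cC cB cD x
patch false x 0 = row cA cB cA cB x
patch false x 1 = row cB cC cB cC x
patch false x 2 = row cA cB cD cA x
patch false x _ = row cB cC cA cB x

between : ℕ → ℕ → ℕ → Bool
between c d x = (c ≤ᵇ x) ∧ (x ≤ᵇ d)

inPatch : ℕ → ℕ → ℕ → Bool
inPatch m x y = odd m ∧ (between (⌊ m /2⌋ ∸ 1) (⌊ m /2⌋ + 2) x ∧ between (⌊ m /2⌋ ∸ 1) (⌊ m /2⌋ + 2) y)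

interiorColour : ℕ → ℕ → ℕ → Colour
interiorColour m x y =
  if inPatch m x y then patch (odd ⌊ m /2⌋) (x ∸ (⌊ m /2⌋ ∸ 1)) (y ∸ (⌊ m /2⌋ ∸ 1)) else ringCol m x y

-- rows of interior colours, listed from x = 1
interior3 : ℕ → ℕ → Colour
interior3 x 1 = row cA cB cA cA (x ∸ 1)
interior3 x _ = row cD cA cA cA (x ∸ 1)

interior5 : ℕ → ℕ → Colour
interior5 x 1 = row cA cB cA cB (x ∸ 1)
interior5 x 2 = row cB cC cB cD (x ∸ 1)
interior5 x 3 = row cA cB cA cB (x ∸ 1)
interior5 x _ = row cB cD cC cA (x ∸ 1)

-- the interior colouring; m = 3 and m = 5 are too small for ring and patch
inner : ℕ → ℕ → ℕ → Colour
inner 3 = interior3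
inner 5 = interior5
inner m = interiorColour m

-- the colour of (x, y) ∈ [0, m]²: the boundary, numbered anticlockwise from
-- the origin as in outerFace, gets W; the interior gets inner
colour : ℕ → ℕ → ℕ → Colour
colour m x y with y ≟ 0
... | yes _ = W x
... | no _ with x ≟ m
...   | yes _ = W (m + y)
...   | no _ with y ≟ m
...     | yes _ = W (m + (m + (m ∸ x)))
...     | no _ with x ≟ 0
...       | yes _ = W (m + (m + (m + (m ∸ y))))
...       | no _ = inner m x y

GoodAt : (ℕ → ℕ → Colour) → ℕ → ℕ → Set
GoodAt f i j = GoodSquare (f i j) (f (suc i) j) (f (suc i) (suc j)) (f i (suc j))

goodAt? : ∀ f i j → Dec (GoodAt f i j)
goodAt? f i j = ¬? (a ≟ᶠ b) ×-dec ¬? (b ≟ᶠ c) ×-dec ¬? (c ≟ᶠ d) ×-dec ¬? (d ≟ᶠ a) ×-dec ¬? ((a ≟ᶠ c) ×-dec (b ≟ᶠ d))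
  where
  a = f i j
  b = f (suc i) j
  c = f (suc i) (suc j)
  d = f i (suc j)

decideBox : ∀ {P : ℕ → ℕ → Set} (P? : ∀ u v → Dec (P u v)) k →
  True (all? λ (u : Fin k) → all? λ (v : Fin k) → P? (toℕ u) (toℕ v)) →
  ∀ u v → u < k → v < k → P u v
decideBox {P} P? k ok u v u<k v<k =
  subst₂ P (toℕ-fromℕ< u<k) (toℕ-fromℕ< v<k) (toWitness ok (fromℕ< u<k) (fromℕ< v<k))

colour-right : ∀ m y → y ≢ 0 → colour m m y ≡ W (m + y)
colour-right m y y≢0 with y ≟ 0
... | yes y≡0 = contradiction y≡0 y≢0
... | no _ with m ≟ m
...   | yes _ = refl
...   | no m≢m = contradiction refl m≢m

colour-top : ∀ m x → m ≢ 0 → x ≢ m → colour m x m ≡ W (m + (m + (m ∸ x)))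
colour-top m x m≢0 x≢m with m ≟ 0
... | yes m≡0 = contradiction m≡0 m≢0
... | no _ with x ≟ m
...   | yes x≡m = contradiction x≡m x≢m
...   | no _ with m ≟ m
...     | yes _ = refl
...     | no m≢m = contradiction refl m≢m

colour-left : ∀ m y → y ≢ 0 → m ≢ 0 → y ≢ m → colour m 0 y ≡ W (m + (m + (m + (m ∸ y))))
colour-left m y y≢0 m≢0 y≢m with y ≟ 0
... | yes y≡0 = contradiction y≡0 y≢0
... | no _ with 0 ≟ m
...   | yes 0≡m = contradiction (sym 0≡m) m≢0
...   | no _ with y ≟ m
...     | yes y≡m = contradiction y≡m y≢m
...     | no _ = refl

colour-inner : ∀ m x y → x ≢ 0 → y ≢ 0 → x ≢ m → y ≢ m → colour m x y ≡ inner m x y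
colour-inner m x y x≢0 y≢0 x≢m y≢m with y ≟ 0
... | yes y≡0 = contradiction y≡0 y≢0
... | no _ with x ≟ m
...   | yes x≡m = contradiction x≡m x≢m
...   | no _ with y ≟ m
...     | yes y≡m = contradiction y≡m y≢m
...     | no _ with x ≟ 0
...       | yes x≡0 = contradiction x≡0 x≢0
...       | no _ = refl

odd-double : ∀ a b → odd (a + (a + b)) ≡ odd b
odd-double a b = begin
  odd (a + (a + b))            ≡⟨ cong odd (+-assoc a a b) ⟨
  odd (a + a + b)              ≡⟨ odd-+ (a + a) b ⟩
  odd (a + a) xor odd b        ≡⟨ cong (λ z → odd z xor odd b) (dbl≡+ a) ⟨
  odd (dbl a) xor odd b        ≡⟨ cong (_xor odd b) (odd-dbl a) ⟩
  odd b                        ∎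

∸-pred : ∀ {i m} → suc i ≤ m → m ∸ i ≡ suc (m ∸ suc i)
∸-pred {zero} (s≤s _) = refl
∸-pred {suc i} (s≤s si≤m) = ∸-pred si≤m

+-suc² : ∀ m t → m + (m + suc t) ≡ suc (m + (m + t))
+-suc² m t = trans (cong (m +_) (+-suc m t)) (+-suc m (m + t))

≤ᵇ-false : ∀ {a b} → b < a → (a ≤ᵇ b) ≡ false
≤ᵇ-false {a} {b} b<a with a ≤ᵇ b in e
... | false = refl
... | true = contradiction (≤ᵇ⇒≤ a b (subst T (sym e) tt)) (<⇒≱ b<a)

between-below : ∀ c d {x} → x < c → between c d x ≡ false
between-below c d x<c = cong (_∧ _) (≤ᵇ-false x<c)

between-above : ∀ c d {x} → d < x → between c d x ≡ false
between-above c d {x} d<x = trans (cong ((c ≤ᵇ x) ∧_) (≤ᵇ-false d<x)) (Bool.∧-zeroʳ (c ≤ᵇ x))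

inPatch-x : ∀ m x y → between (⌊ m /2⌋ ∸ 1) (⌊ m /2⌋ + 2) x ≡ false → inPatch m x y ≡ false
inPatch-x m x y out rewrite out = Bool.∧-zeroʳ (odd m)

inPatch-y : ∀ m x y → between (⌊ m /2⌋ ∸ 1) (⌊ m /2⌋ + 2) y ≡ false → inPatch m x y ≡ false
inPatch-y m x y out rewrite out | Bool.∧-zeroʳ (between (⌊ m /2⌋ ∸ 1) (⌊ m /2⌋ + 2) x) = Bool.∧-zeroʳ (odd m)

inPatch-even : ∀ m x y → odd m ≡ false → inPatch m x y ≡ false
inPatch-even m x y om rewrite om = refl

inPatch-odd : ∀ m x y → odd m ≡ true →
  inPatch m x y ≡ (between (⌊ m /2⌋ ∸ 1) (⌊ m /2⌋ + 2) x ∧ between (⌊ m /2⌋ ∸ 1) (⌊ m /2⌋ + 2) y)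
inPatch-odd m x y om rewrite om = refl

if-false : ∀ {A : Set} {b : Bool} {x y : A} → b ≡ false → (if b then x else y) ≡ y
if-false refl = refl

if-true : ∀ {A : Set} {b : Bool} {x y : A} → b ≡ true → (if b then x else y) ≡ x
if-true refl = refl

≤ᵇ-shift : ∀ a s t → (a + s ≤ᵇ a + t) ≡ (s ≤ᵇ t)
≤ᵇ-shift zero s t = refl
≤ᵇ-shift (suc a) s t = trans (suc-≤ᵇ (a + s) (a + t)) (≤ᵇ-shift a s t)
  where
  suc-≤ᵇ : ∀ x y → (suc x ≤ᵇ suc y) ≡ (x ≤ᵇ y)
  suc-≤ᵇ zero y = refl
  suc-≤ᵇ (suc x) y = refl

between-shift : ∀ a c d x → between (a + c) (a + d) (a + x) ≡ between c d x
between-shift a c d x = cong₂ _∧_ (≤ᵇ-shift a c x) (≤ᵇ-shift a x d)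

odd-decomp : ∀ n → odd n ≡ true → n ≡ suc (⌊ n /2⌋ + ⌊ n /2⌋)
odd-decomp n on with halving n
... | twice q with () ← trans (sym (odd-dbl q)) on
... | twice+1 q = cong suc (trans (dbl≡+ q) (sym (cong₂ _+_ (halve-dbl+1 q) (halve-dbl+1 q))))

-- the 6×6 block around the central patch, in local coordinates u, v ≤ 5:
-- the patch occupies [1, 4]², the border carries ring colours of parity b
inBlockPatch : ℕ → ℕ → Bool
inBlockPatch u v = between 1 4 u ∧ between 1 4 v

block : Bool → ℕ → ℕ → Colour
block b u v = if inBlockPatch u v then patch b (u ∸ 1) (v ∸ 1) else ringColour b (odd (u + v))

block-good : ∀ b u v → u < 5 → v < 5 → GoodAt (block b) u v
block-good true = decideBox (goodAt? (block true)) 5 tt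
block-good false = decideBox (goodAt? (block false)) 5 tt

block-border : ∀ u v → u < 6 → v < 6 → inBlockPatch u v ≡ false → (u ⊓ (5 ∸ u)) ⊓ (v ⊓ (5 ∸ v)) ≡ 0
block-border = decideBox (λ u v → (inBlockPatch u v Bool.≟ false) →-dec ((u ⊓ (5 ∸ u)) ⊓ (v ⊓ (5 ∸ v)) ≟ 0)) 6 tt

-- Grids with m = 7 + n ≥ 7.  A unit square is classified by the position
-- (first, middle or last) of its two coordinates: squares touching the
-- boundary reduce to side-good and corner-good, interior squares to the ring
-- colouring or, around the patch, to the evaluated block.

module Large (n : ℕ) where
  m′ m : ℕ
  m′ = 6 + n
  m = suc m′

  m≢0 : m ≢ 0
  m≢0 ()

  -- the patch [k-1, k+2]², k = ⌊ m /2⌋ = 3 + h, lies strictly inside ring 1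
  h : ℕ
  h = ⌊ suc n /2⌋

  patch-below-top : ⌊ m /2⌋ + 2 < m′
  patch-below-top = subst (_< m′) (cong (3 +_) (+-comm 2 h)) (s≤s (s≤s (s≤s (s≤s (s≤s (s≤s (≤-pred (⌊n/2⌋<n n))))))))

  m∸m′ : m ∸ m′ ≡ 1
  m∸m′ = trans (cong (_∸ m′) (+-comm 1 m′)) (m+n∸m≡n m′ 1)

  colour-interior : ∀ x y → 1 ≤ x → x < m → 1 ≤ y → y < m → colour m x y ≡ interiorColour m x y
  colour-interior x y 1≤x x<m 1≤y y<m = colour-inner m x y (n>0⇒n≢0 1≤x) (n>0⇒n≢0 1≤y) (<⇒≢ x<m) (<⇒≢ y<m)

  colour-ring : ∀ x y → 1 ≤ x → x < m → 1 ≤ y → y < m → inPatch m x y ≡ false → colour m x y ≡ ringCol m x y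
  colour-ring x y 1≤x x<m 1≤y y<m out = trans (colour-interior x y 1≤x x<m 1≤y y<m) (if-false out)

  tent-pos : ∀ t → 1 ≤ t → t < m → 1 ≤ tent m t
  tent-pos t 1≤t t<m = ⊓-glb 1≤t (m<n⇒0<n∸m t<m)

  data Rim (x y : ℕ) : Set where
    left-rim   : x ≡ 1 → Rim x y
    right-rim  : x ≡ m′ → Rim x y
    bottom-rim : y ≡ 1 → Rim x y
    top-rim    : y ≡ m′ → Rim x y

  tent-last : tent m m′ ≡ 1
  tent-last = trans (cong (m′ ⊓_) m∸m′) (m≥n⇒m⊓n≡n {m′} (s≤s z≤n))

  rim-ring : ∀ x y → 1 ≤ x → x < m → 1 ≤ y → y < m → Rim x y → ring m x y ≡ 1
  rim-ring x y _ _ 1≤y y<m (left-rim refl) = m≤n⇒m⊓n≡m (tent-pos y 1≤y y<m)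
  rim-ring x y _ _ 1≤y y<m (right-rim refl) = trans (cong (_⊓ tent m y) tent-last) (m≤n⇒m⊓n≡m (tent-pos y 1≤y y<m))
  rim-ring x y 1≤x x<m _ _ (bottom-rim refl) = m≥n⇒m⊓n≡n (tent-pos x 1≤x x<m)
  rim-ring x y 1≤x x<m _ _ (top-rim refl) = trans (cong (tent m x ⊓_) tent-last) (m≥n⇒m⊓n≡n (tent-pos x 1≤x x<m))

  rim-outside-patch : ∀ x y → Rim x y → inPatch m x y ≡ false
  rim-outside-patch x y (left-rim refl) = inPatch-x m 1 y (between-below (⌊ m /2⌋ ∸ 1) (⌊ m /2⌋ + 2) (s≤s (s≤s z≤n)))
  rim-outside-patch x y (right-rim refl) = inPatch-x m m′ y (between-above (⌊ m /2⌋ ∸ 1) (⌊ m /2⌋ + 2) patch-below-top)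
  rim-outside-patch x y (bottom-rim refl) = inPatch-y m x 1 (between-below (⌊ m /2⌋ ∸ 1) (⌊ m /2⌋ + 2) (s≤s (s≤s z≤n)))
  rim-outside-patch x y (top-rim refl) = inPatch-y m x m′ (between-above (⌊ m /2⌋ ∸ 1) (⌊ m /2⌋ + 2) patch-below-top)

  colour-rim : ∀ x y → 1 ≤ x → x < m → 1 ≤ y → y < m → Rim x y → colour m x y ≡ rim (odd (x + y))
  colour-rim x y 1≤x x<m 1≤y y<m r =
    trans (colour-ring x y 1≤x x<m 1≤y y<m (rim-outside-patch x y r))
          (cong (λ z → ringColour (odd z) (odd (x + y))) (rim-ring x y 1≤x x<m 1≤y y<m r))

  -- unit squares touching the boundary; first the corner (0, 0): the marker,
  -- W 1, the ring-1 vertex (1, 1) and W (4m - 1)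
  origin-square : GoodAt (colour m) 0 0
  origin-square = good-resp refl refl
    (colour-rim 1 1 ≤-refl (s≤s (s≤s z≤n)) ≤-refl (s≤s (s≤s z≤n)) (left-rim refl))
    (colour-left m 1 (λ ()) m≢0 (λ ()))
    (origin-good (m + (m + (m + m′))) odd-index)
    where
    odd-index : odd (m + (m + (m + m′))) ≡ true
    odd-index = begin
      odd (m + (m + (m + m′)))  ≡⟨ odd-double m (m + m′) ⟩
      odd (suc (m′ + m′))       ≡⟨ cong (odd ∘ suc) (dbl≡+ m′) ⟨
      odd (suc (dbl m′))        ≡⟨ odd-dbl+1 m′ ⟩
      true                      ∎

  bottom-side : ∀ i → 1 ≤ i → suc i < m → GoodAt (colour m) i 0
  bottom-side i 1≤i si<m = good-resp refl refl
    (trans (colour-rim (suc i) 1 (s≤s z≤n) si<m ≤-refl (s≤s (s≤s z≤n)) (bottom-rim refl))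
           (cong (rim ∘ odd) (+-comm (suc i) 1)))
    (trans (colour-rim i 1 1≤i (<-trans (n<1+n i) si<m) ≤-refl (s≤s (s≤s z≤n)) (bottom-rim refl))
           (cong rim (trans (cong odd (+-comm i 1)) (odd-suc i))))
    (side-good i 1≤i)

  -- corner (m, 0): boundary vertices m - 1, m, m + 1
  bottom-right-corner : GoodAt (colour m) m′ 0
  bottom-right-corner = good-resp refl refl
    (trans (colour-right m 1 (λ ())) (cong W (+-comm m 1)))
    (trans (colour-rim m′ 1 (s≤s z≤n) (n<1+n m′) ≤-refl (s≤s (s≤s z≤n)) (right-rim refl))
           (cong (rim ∘ odd) (+-comm m′ 1)))
    (corner-good m′ (s≤s z≤n))

  -- right side: the boundary edge m + j, m + j + 1
  right-side : ∀ j → 1 ≤ j → suc j < m → GoodAt (colour m) m′ j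
  right-side j 1≤j sj<m = good-resp
    (trans (colour-rim m′ j (s≤s z≤n) (n<1+n m′) 1≤j (<-trans (n<1+n j) sj<m) (right-rim refl))
           (cong rim (sym (trans (cong not (odd-suc (m′ + j))) (Bool.not-involutive _)))))
    (colour-right m j (n>0⇒n≢0 1≤j))
    (trans (colour-right m (suc j) (λ ())) (cong W (+-suc m j)))
    (trans (colour-rim m′ (suc j) (s≤s z≤n) (n<1+n m′) (s≤s z≤n) sj<m (right-rim refl))
           (cong (rim ∘ odd) (+-suc m′ j)))
    (rotate³ (side-good (m + j) (s≤s z≤n)))

  -- corner (m, m): boundary vertices 2m - 1, 2m, 2m + 1
  top-right-corner : GoodAt (colour m) m′ m′
  top-right-corner = good-resp
    (colour-rim m′ m′ (s≤s z≤n) (n<1+n m′) (s≤s z≤n) (n<1+n m′) (right-rim refl))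
    (colour-right m m′ (λ ()))
    (trans (colour-right m m m≢0) (cong W (+-suc m m′)))
    (trans (colour-top m m′ m≢0 (<⇒≢ (n<1+n m′))) (cong W (begin
      m + (m + (m ∸ m′))     ≡⟨ cong (λ z → m + (m + z)) m∸m′ ⟩
      m + (m + 1)            ≡⟨ cong (m +_) (+-comm m 1) ⟩
      m + suc m              ≡⟨ +-suc m m ⟩
      suc (m + suc m′)       ≡⟨ cong suc (+-suc m m′) ⟩
      suc (suc (m + m′))     ∎)))
    (rotate³ (corner-good (m + m′) (s≤s z≤n)))

  -- top side: the boundary edge 3m - i - 1, 3m - i
  top-side : ∀ i → 1 ≤ i → suc i < m → GoodAt (colour m) i m′
  top-side i 1≤i si<m = good-resp
    (trans (colour-rim i m′ 1≤i i<m (s≤s z≤n) (n<1+n m′) (top-rim refl)) (cong rim parity))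
    (trans (colour-rim (suc i) m′ (s≤s z≤n) si<m (s≤s z≤n) (n<1+n m′) (top-rim refl))
           (cong rim (trans (odd-suc (i + m′)) (cong not parity))))
    (colour-top m (suc i) m≢0 (<⇒≢ si<m))
    (trans (colour-top m i m≢0 (<⇒≢ i<m)) (cong W (trans (cong (λ z → m + (m + z)) (∸-pred (<⇒≤ si<m))) (+-suc² m t))))
    (rotate² (side-good (m + (m + t)) (s≤s z≤n)))
    where
    i<m : i < m
    i<m = <-trans (n<1+n i) si<m
    t = m ∸ suc i
    t+i : t + i ≡ m′
    t+i = suc-injective (trans (sym (+-suc t i)) (m∸n+n≡m (<⇒≤ si<m)))
    parity : odd (i + m′) ≡ odd (m + (m + t))
    parity = begin
      odd (i + m′)           ≡⟨ cong (λ z → odd (i + z)) (trans (sym t+i) (+-comm t i)) ⟩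
      odd (i + (i + t))      ≡⟨ odd-double i t ⟩
      odd t                  ≡⟨ odd-double m t ⟨
      odd (m + (m + t))      ∎

  -- corner (0, m): boundary vertices 3m - 1, 3m, 3m + 1
  top-left-corner : GoodAt (colour m) 0 m′
  top-left-corner = good-resp
    (trans (colour-left m m′ (λ ()) m≢0 (<⇒≢ (n<1+n m′))) (cong W (begin
      m + (m + (m + (m ∸ m′)))   ≡⟨ cong (λ z → m + (m + (m + z))) m∸m′ ⟩
      m + (m + (m + 1))          ≡⟨ cong (λ z → m + (m + z)) (+-comm m 1) ⟩
      m + (m + suc m)            ≡⟨ +-suc² m m ⟩
      suc (m + (m + m))          ≡⟨ cong suc (+-suc² m m′) ⟩
      suc (suc (m + (m + m′)))   ∎)))
    (trans (colour-rim 1 m′ ≤-refl (s≤s (s≤s z≤n)) (s≤s z≤n) (n<1+n m′) (left-rim refl))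
           (cong rim (sym (trans (cong odd (sym (+-suc² m m′))) (odd-double m m)))))
    (colour-top m 1 m≢0 (λ ()))
    (trans (colour-top m 0 m≢0 (λ ())) (cong W (+-suc² m m′)))
    (rotate² (corner-good (m + (m + m′)) (s≤s z≤n)))

  -- left side: the boundary edge 4m - j - 1, 4m - j
  left-side : ∀ j → 1 ≤ j → suc j < m → GoodAt (colour m) 0 j
  left-side j 1≤j sj<m = good-resp
    (trans (colour-left m j (n>0⇒n≢0 1≤j) m≢0 (<⇒≢ j<m))
           (cong W (trans (cong (λ z → m + (m + (m + z))) (∸-pred (<⇒≤ sj<m))) (trans (cong (m +_) (+-suc² m t)) (+-suc m _)))))
    (trans (colour-rim 1 j ≤-refl (s≤s (s≤s z≤n)) 1≤j j<m (left-rim refl)) (cong rim parity))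
    (trans (colour-rim 1 (suc j) ≤-refl (s≤s (s≤s z≤n)) (s≤s z≤n) sj<m (left-rim refl))
           (cong rim (trans (sym (Bool.not-involutive (odd j))) (cong not (trans (sym (odd-suc j)) parity)))))
    (colour-left m (suc j) (λ ()) m≢0 (<⇒≢ sj<m))
    (rotate (side-good (m + (m + (m + t))) (s≤s z≤n)))
    where
    j<m : j < m
    j<m = <-trans (n<1+n j) sj<m
    t = m ∸ suc j
    parity : odd (suc j) ≡ odd (m + (m + (m + t)))
    parity = begin
      odd (suc j)                ≡⟨ odd-double t (suc j) ⟨
      odd (t + (t + suc j))      ≡⟨ cong odd (trans (+-comm t (t + suc j)) (cong (_+ t) (m∸n+n≡m (<⇒≤ sj<m)))) ⟩
      odd (m + t)                ≡⟨ odd-double m (m + t) ⟨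
      odd (m + (m + (m + t)))    ∎

  interior-even : odd m ≡ false → ∀ i j → 1 ≤ i → suc i < m → 1 ≤ j → suc j < m → GoodAt (colour m) i j
  interior-even om i j 1≤i si<m 1≤j sj<m = good-resp
    (colour-ring i j 1≤i (<-trans (n<1+n i) si<m) 1≤j (<-trans (n<1+n j) sj<m) (no-patch i j))
    (colour-ring (suc i) j (s≤s z≤n) si<m 1≤j (<-trans (n<1+n j) sj<m) (no-patch (suc i) j))
    (colour-ring (suc i) (suc j) (s≤s z≤n) si<m (s≤s z≤n) sj<m (no-patch (suc i) (suc j)))
    (colour-ring i (suc j) 1≤i (<-trans (n<1+n i) si<m) (s≤s z≤n) sj<m (no-patch i (suc j)))
    (ringCol-good m i j (<-trans (n<1+n i) si<m) (<-trans (n<1+n j) sj<m) not-centre)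
    where
    no-patch : ∀ x y → inPatch m x y ≡ false
    no-patch x y = inPatch-even m x y om
    not-centre : ¬ (m ≡ suc (i + i) × j ≡ i)
    not-centre (centre , _) with () ← trans (sym om) (trans (cong odd centre) (trans (cong (odd ∘ suc) (sym (dbl≡+ i))) (odd-dbl+1 i)))

  -- interior unit squares of an odd grid: the block [a, a+5]² around the
  -- patch is checked by evaluation, all other squares avoid the patch
  module OddGrid (om : odd m ≡ true) where
    k a : ℕ
    k = ⌊ m /2⌋
    a = suc h

    width : m ≡ a + (a + 5)
    width = trans (odd-decomp m om) (arith h)
      where
      arith : ∀ h → suc ((3 + h) + (3 + h)) ≡ suc h + (suc h + 5)
      arith = solve-∀

    patch-top : ⌊ m /2⌋ + 2 ≡ a + 4
    patch-top = trans (cong (suc ∘ suc) (+-comm a 2)) (+-comm 4 a)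

    in-patch : ∀ u v → inPatch m (a + u) (a + v) ≡ inBlockPatch u v
    in-patch u v = begin
      inPatch m (a + u) (a + v)
        ≡⟨ inPatch-odd m (a + u) (a + v) om ⟩
      between (suc a) (k + 2) (a + u) ∧ between (suc a) (k + 2) (a + v)
        ≡⟨ cong₂ (λ c d → between c d (a + u) ∧ between c d (a + v)) (+-comm 1 a) patch-top ⟩
      between (a + 1) (a + 4) (a + u) ∧ between (a + 1) (a + 4) (a + v)
        ≡⟨ cong₂ _∧_ (between-shift a 1 4 u) (between-shift a 1 4 v) ⟩
      inBlockPatch u v  ∎

    tent-block : ∀ u → u ≤ 5 → tent m (a + u) ≡ a + (u ⊓ (5 ∸ u))
    tent-block u u≤5 = begin
      (a + u) ⊓ (m ∸ (a + u))               ≡⟨ cong (λ z → (a + u) ⊓ (z ∸ (a + u))) width ⟩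
      (a + u) ⊓ ((a + (a + 5)) ∸ (a + u))   ≡⟨ cong ((a + u) ⊓_) ([m+n]∸[m+o]≡n∸o a (a + 5) u) ⟩
      (a + u) ⊓ ((a + 5) ∸ u)               ≡⟨ cong ((a + u) ⊓_) (+-∸-assoc a u≤5) ⟩
      (a + u) ⊓ (a + (5 ∸ u))               ≡⟨ +-distribˡ-⊓ a u (5 ∸ u) ⟨
      a + (u ⊓ (5 ∸ u))                     ∎

    ring-border : ∀ u v → u ≤ 5 → v ≤ 5 → inBlockPatch u v ≡ false → ring m (a + u) (a + v) ≡ a
    ring-border u v u≤5 v≤5 border = begin
      tent m (a + u) ⊓ tent m (a + v)                 ≡⟨ cong₂ _⊓_ (tent-block u u≤5) (tent-block v v≤5) ⟩
      (a + (u ⊓ (5 ∸ u))) ⊓ (a + (v ⊓ (5 ∸ v)))       ≡⟨ +-distribˡ-⊓ a _ _ ⟨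
      a + ((u ⊓ (5 ∸ u)) ⊓ (v ⊓ (5 ∸ v)))             ≡⟨ cong (a +_) (block-border u v (s≤s u≤5) (s≤s v≤5) border) ⟩
      a + 0                                           ≡⟨ +-identityʳ a ⟩
      a                                               ∎

    block-parity : ∀ u v → odd ((a + u) + (a + v)) ≡ odd (u + v)
    block-parity u v = trans (cong odd rearrange) (odd-double a (u + v))
      where
      rearrange : (a + u) + (a + v) ≡ a + (a + (u + v))
      rearrange = begin
        (a + u) + (a + v)    ≡⟨ +-assoc a u (a + v) ⟩
        a + (u + (a + v))    ≡⟨ cong (a +_) (+-comm u (a + v)) ⟩
        a + ((a + v) + u)    ≡⟨ cong (a +_) (+-assoc a v u) ⟩
        a + (a + (v + u))    ≡⟨ cong (λ z → a + (a + z)) (+-comm v u) ⟩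
        a + (a + (u + v))    ∎

    in-grid : ∀ u → u ≤ 5 → a + u < m
    in-grid u u≤5 = subst (a + u <_) (sym width) (+-monoʳ-< a (s≤s (≤-trans u≤5 (m≤n+m 5 h))))

    colour-block : ∀ u v → u ≤ 5 → v ≤ 5 → colour m (a + u) (a + v) ≡ block (odd k) u v
    colour-block u v u≤5 v≤5 = trans
      (colour-interior (a + u) (a + v) (s≤s z≤n) (in-grid u u≤5) (s≤s z≤n) (in-grid v v≤5))
      (by-patch (inBlockPatch u v) refl)
      where
      local : ∀ w → (a + w) ∸ (k ∸ 1) ≡ w ∸ 1
      local w = trans (cong ((a + w) ∸_) (+-comm 1 a)) ([m+n]∸[m+o]≡n∸o a w 1)
      by-patch : ∀ b → inBlockPatch u v ≡ b → interiorColour m (a + u) (a + v) ≡ block (odd k) u v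
      by-patch true e = begin
        interiorColour m (a + u) (a + v)        ≡⟨ if-true (trans (in-patch u v) e) ⟩
        patch (odd k) ((a + u) ∸ (k ∸ 1)) ((a + v) ∸ (k ∸ 1)) ≡⟨ cong₂ (patch (odd k)) (local u) (local v) ⟩
        patch (odd k) (u ∸ 1) (v ∸ 1)           ≡⟨ if-true e ⟨
        block (odd k) u v                       ∎
      by-patch false e = begin
        interiorColour m (a + u) (a + v)        ≡⟨ if-false (trans (in-patch u v) e) ⟩
        ringCol m (a + u) (a + v)               ≡⟨ cong₂ ringColour (cong odd (ring-border u v u≤5 v≤5 e)) (block-parity u v) ⟩
        ringColour (odd k) (odd (u + v))        ≡⟨ if-false e ⟨
        block (odd k) u v                       ∎

    data AwayFromPatch (x y : ℕ) : Set where
      left-of  : x < suc a → AwayFromPatch x y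
      right-of : a + 4 < x → AwayFromPatch x y
      below    : y < suc a → AwayFromPatch x y
      above    : a + 4 < y → AwayFromPatch x y

    away-no-patch : ∀ x y → AwayFromPatch x y → inPatch m x y ≡ false
    away-no-patch x y (left-of x<) = inPatch-x m x y (between-below (⌊ m /2⌋ ∸ 1) (⌊ m /2⌋ + 2) x<)
    away-no-patch x y (right-of <x) = inPatch-x m x y (between-above (⌊ m /2⌋ ∸ 1) (⌊ m /2⌋ + 2) (subst (_< x) (sym patch-top) <x))
    away-no-patch x y (below y<) = inPatch-y m x y (between-below (⌊ m /2⌋ ∸ 1) (⌊ m /2⌋ + 2) y<)
    away-no-patch x y (above <y) = inPatch-y m x y (between-above (⌊ m /2⌋ ∸ 1) (⌊ m /2⌋ + 2) (subst (_< y) (sym patch-top) <y))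

    data Far (i j : ℕ) : Set where
      far-left  : i < a → Far i j
      far-right : a + 4 < i → Far i j
      far-below : j < a → Far i j
      far-above : a + 4 < j → Far i j

    far-away : ∀ {i j} → Far i j → ∀ dx dy → dx ≤ 1 → dy ≤ 1 → AwayFromPatch (dx + i) (dy + j)
    far-away (far-left i<a) dx dy dx≤1 _ = left-of (s≤s (≤-trans (+-monoˡ-≤ _ dx≤1) i<a))
    far-away {i} (far-right <i) dx dy _ _ = right-of (<-≤-trans <i (m≤n+m i dx))
    far-away (far-below j<a) dx dy _ dy≤1 = below (s≤s (≤-trans (+-monoˡ-≤ _ dy≤1) j<a))
    far-away {j = j} (far-above <j) dx dy _ _ = above (<-≤-trans <j (m≤n+m j dy))

    centre-not-far : ¬ Far (suc (suc a)) (suc (suc a))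
    centre-not-far (far-left c<a) = <⇒≱ c<a (≤-trans (n≤1+n a) (n≤1+n (suc a)))
    centre-not-far (far-right <c) = <⇒≱ <c (≤-trans (≤-reflexive (+-comm 2 a)) (+-monoʳ-≤ a (s≤s (s≤s z≤n))))
    centre-not-far (far-below c<a) = <⇒≱ c<a (≤-trans (n≤1+n a) (n≤1+n (suc a)))
    centre-not-far (far-above <c) = <⇒≱ <c (≤-trans (≤-reflexive (+-comm 2 a)) (+-monoʳ-≤ a (s≤s (s≤s z≤n))))

    far-square : ∀ i j → 1 ≤ i → suc i < m → 1 ≤ j → suc j < m → Far i j → GoodAt (colour m) i j
    far-square i j 1≤i si<m 1≤j sj<m far = good-resp
      (ring-vertex 0 0 z≤n z≤n) (ring-vertex 1 0 ≤-refl z≤n) (ring-vertex 1 1 ≤-refl ≤-refl) (ring-vertex 0 1 z≤n ≤-refl)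
      (ringCol-good m i j (<-trans (n<1+n i) si<m) (<-trans (n<1+n j) sj<m) not-centre)
      where
      ring-vertex : ∀ dx dy → dx ≤ 1 → dy ≤ 1 → colour m (dx + i) (dy + j) ≡ ringCol m (dx + i) (dy + j)
      ring-vertex dx dy dx≤1 dy≤1 = colour-ring (dx + i) (dy + j)
        (≤-trans 1≤i (m≤n+m i dx)) (≤-<-trans (+-monoˡ-≤ i dx≤1) si<m)
        (≤-trans 1≤j (m≤n+m j dy)) (≤-<-trans (+-monoˡ-≤ j dy≤1) sj<m)
        (away-no-patch (dx + i) (dy + j) (far-away far dx dy dx≤1 dy≤1))
      not-centre : ¬ (m ≡ suc (i + i) × j ≡ i)
      not-centre (centre , j≡i) = centre-not-far (subst₂ Far i≡k (trans j≡i i≡k) far)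
        where
        i≡k : i ≡ suc (suc a)
        i≡k = dbl-injective (suc-injective (trans (sym centre) (odd-decomp m om)))

    near-square : ∀ i j → a ≤ i → i ≤ a + 4 → a ≤ j → j ≤ a + 4 → GoodAt (colour m) i j
    near-square i j a≤i i≤ a≤j j≤ = subst₂ (GoodAt (colour m)) (m+[n∸m]≡n a≤i) (m+[n∸m]≡n a≤j)
      (good-resp (block-vertex 0 0 z≤n z≤n) (block-vertex 1 0 ≤-refl z≤n)
                 (block-vertex 1 1 ≤-refl ≤-refl) (block-vertex 0 1 z≤n ≤-refl)
                 (block-good (odd k) u v (s≤s u≤4) (s≤s v≤4)))
      where
      u = i ∸ a
      v = j ∸ a
      u≤4 : u ≤ 4
      u≤4 = +-cancelˡ-≤ a u 4 (subst (_≤ a + 4) (sym (m+[n∸m]≡n a≤i)) i≤)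
      v≤4 : v ≤ 4
      v≤4 = +-cancelˡ-≤ a v 4 (subst (_≤ a + 4) (sym (m+[n∸m]≡n a≤j)) j≤)
      shift : ∀ d w → d + (a + w) ≡ a + (d + w)
      shift d w = trans (sym (+-assoc d a w)) (trans (cong (_+ w) (+-comm d a)) (+-assoc a d w))
      block-vertex : ∀ du dv → du ≤ 1 → dv ≤ 1 → colour m (du + (a + u)) (dv + (a + v)) ≡ block (odd k) (du + u) (dv + v)
      block-vertex du dv du≤1 dv≤1 = trans (cong₂ (colour m) (shift du u) (shift dv v))
        (colour-block (du + u) (dv + v) (+-mono-≤ du≤1 u≤4) (+-mono-≤ dv≤1 v≤4))

    interior-odd : ∀ i j → 1 ≤ i → suc i < m → 1 ≤ j → suc j < m → GoodAt (colour m) i j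
    interior-odd i j 1≤i si<m 1≤j sj<m with a ≤? i | i ≤? a + 4 | a ≤? j | j ≤? a + 4
    ... | yes a≤i | yes i≤ | yes a≤j | yes j≤ = near-square i j a≤i i≤ a≤j j≤
    ... | no a≰i | _ | _ | _ = far-square i j 1≤i si<m 1≤j sj<m (far-left (≰⇒> a≰i))
    ... | yes _ | no i≰ | _ | _ = far-square i j 1≤i si<m 1≤j sj<m (far-right (≰⇒> i≰))
    ... | yes _ | yes _ | no a≰j | _ = far-square i j 1≤i si<m 1≤j sj<m (far-below (≰⇒> a≰j))
    ... | yes _ | yes _ | yes _ | no j≰ = far-square i j 1≤i si<m 1≤j sj<m (far-above (≰⇒> j≰))

  interior-square : ∀ i j → 1 ≤ i → suc i < m → 1 ≤ j → suc j < m → GoodAt (colour m) i j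
  interior-square = by-parity (odd m) refl
    where
    by-parity : ∀ b → odd m ≡ b → ∀ i j → 1 ≤ i → suc i < m → 1 ≤ j → suc j < m → GoodAt (colour m) i j
    by-parity true om = OddGrid.interior-odd om
    by-parity false om = interior-even om

  data Position (i : ℕ) : Set where
    first  : i ≡ 0 → Position i
    middle : 1 ≤ i → suc i < m → Position i
    last   : i ≡ m′ → Position i

  position : ∀ i → i < m → Position i
  position zero _ = first refl
  position (suc i) si<m with suc (suc i) <? m
  ... | yes ssi<m = middle (s≤s z≤n) ssi<m
  ... | no ssi≮m = last (suc-injective (≤-antisym si<m (≮⇒≥ ssi≮m)))

  large-good : ∀ i j → i < m → j < m → GoodAt (colour m) i j
  large-good i j i<m j<m with position i i<m | position j j<m
  ... | first refl | first refl = origin-square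
  ... | middle 1≤i si<m | first refl = bottom-side i 1≤i si<m
  ... | last refl | first refl = bottom-right-corner
  ... | last refl | middle 1≤j sj<m = right-side j 1≤j sj<m
  ... | last refl | last refl = top-right-corner
  ... | middle 1≤i si<m | last refl = top-side i 1≤i si<m
  ... | first refl | last refl = top-left-corner
  ... | first refl | middle 1≤j sj<m = left-side j 1≤j sj<m
  ... | middle 1≤i si<m | middle 1≤j sj<m = interior-square i j 1≤i si<m 1≤j sj<m

all-squares-good : ∀ m i j → i < m → j < m → GoodAt (colour m) i j
all-squares-good 0 i j ()
all-squares-good 1 = decideBox (goodAt? (colour 1)) 1 tt
all-squares-good 2 = decideBox (goodAt? (colour 2)) 2 tt
all-squares-good 3 = decideBox (goodAt? (colour 3)) 3 tt
all-squares-good 4 = decideBox (goodAt? (colour 4)) 4 tt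
all-squares-good 5 = decideBox (goodAt? (colour 5)) 5 tt
all-squares-good 6 = decideBox (goodAt? (colour 6)) 6 tt
all-squares-good (suc (suc (suc (suc (suc (suc (suc n))))))) = Large.large-good n

gridColouring : (m : ℕ) → Fin (suc m) → Fin (suc m) → Colour
gridColouring m i j = colour m (toℕ i) (toℕ j)

toℕ-clamp : ∀ m x → x ≤ m → toℕ (clamp {m} x) ≡ x
toℕ-clamp zero zero _ = refl
toℕ-clamp (suc m) zero _ = refl
toℕ-clamp (suc m) (suc x) (s≤s x≤m) = cong suc (toℕ-clamp m x x≤m)

colorAt-grid : ∀ m x y → x ≤ m → y ≤ m → colorAt (gridColouring m) (x , y) ≡ colour m x y
colorAt-grid m x y x≤m y≤m = cong₂ (colour m) (toℕ-clamp m x x≤m) (toℕ-clamp m y y≤m)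

square-faces : ∀ m i j → i < m → j < m → ∀ P → FacialPathOf (squareFace i j) P →
  Nonrepetitive (map (colorAt (gridColouring m)) P)
square-faces m i j i<m j<m = square-face-nonrep (colorAt (gridColouring m)) i j
  (good-resp (colorAt-grid m i j (<⇒≤ i<m) (<⇒≤ j<m)) (colorAt-grid m (suc i) j i<m (<⇒≤ j<m))
             (colorAt-grid m (suc i) (suc j) i<m j<m) (colorAt-grid m i (suc j) (<⇒≤ i<m) j<m)
             (all-squares-good m i j i<m j<m))

read-last : ∀ {V C : Set} (c : V → C) (h : ℕ → V) m (f : ℕ → C) →
  (∀ q → q < m → c (h q) ≡ f q) → ∀ p → p < m → at (map c (applyUpTo h m)) p ≡ just (f p)
read-last c h m f side p p<m =
  trans (at-map c (applyUpTo h m) p) (trans (cong (Maybe.map c) (at-applyUpTo h m p p<m)) (cong just (side p p<m)))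

read-segment : ∀ {V C : Set} (c : V → C) (h : ℕ → V) m (R : List V) k (f : ℕ → C) →
  (∀ q → q < m → c (h q) ≡ f q) →
  (∀ q → q < k → at (map c R) q ≡ just (f (m + q))) →
  ∀ p → p < m + k → at (map c (applyUpTo h m ++ R)) p ≡ just (f p)
read-segment c h m R k f side rest p p<m+k with p <? m
... | yes p<m = begin
  at (map c (applyUpTo h m ++ R)) p       ≡⟨ cong (λ z → at z p) (map-++ c (applyUpTo h m) R) ⟩
  at (map c (applyUpTo h m) ++ map c R) p ≡⟨ at-++ˡ (map c (applyUpTo h m)) (map c R) p (subst (p <_) (sym (trans (length-map c (applyUpTo h m)) (length-applyUpTo h m))) p<m) ⟩
  at (map c (applyUpTo h m)) p            ≡⟨ read-last c h m f side p p<m ⟩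
  just (f p)                              ∎
... | no p≮m = begin
  at (map c (applyUpTo h m ++ R)) p                   ≡⟨ cong (λ z → at z p) (map-++ c (applyUpTo h m) R) ⟩
  at (map c (applyUpTo h m) ++ map c R) p             ≡⟨ cong (at (map c (applyUpTo h m) ++ map c R)) (sym split) ⟩
  at (map c (applyUpTo h m) ++ map c R) (len + q)     ≡⟨ at-++ʳ (map c (applyUpTo h m)) (map c R) q ⟩
  at (map c R) q                                      ≡⟨ rest q (+-cancelˡ-< m q k (subst (_< m + k) (sym m+q) p<m+k)) ⟩
  just (f (m + q))                                    ≡⟨ cong (just ∘ f) m+q ⟩
  just (f p)                                          ∎
  where
  q = p ∸ m
  len = length (map c (applyUpTo h m))
  m+q : m + q ≡ p
  m+q = m+[n∸m]≡n (≮⇒≥ p≮m)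
  split : len + q ≡ p
  split = trans (cong (_+ q) (trans (length-map c (applyUpTo h m)) (length-applyUpTo h m))) m+q

module OuterFace (m′ : ℕ) where
  m N : ℕ
  m = suc m′
  N = m + (m + (m + m))

  c : ℕ × ℕ → Colour
  c = colorAt (gridColouring m)

  m≢0 : m ≢ 0
  m≢0 ()

  bottom : ∀ q → q < m → c (q , 0) ≡ W q
  bottom q q<m = colorAt-grid m q 0 (<⇒≤ q<m) z≤n

  right : ∀ q → q < m → c (m , q) ≡ W (m + q)
  right zero _ = trans (colorAt-grid m m 0 ≤-refl z≤n) (cong W (sym (+-identityʳ m)))
  right (suc q) q<m = trans (colorAt-grid m m (suc q) ≤-refl (<⇒≤ q<m)) (colour-right m (suc q) λ ())

  top : ∀ q → q < m → c (m ∸ q , m) ≡ W (m + (m + q))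
  top zero _ = trans (colorAt-grid m m m ≤-refl ≤-refl)
    (trans (colour-right m m m≢0) (cong (λ z → W (m + z)) (sym (+-identityʳ m))))
  top (suc q) q<m = trans (colorAt-grid m (m ∸ suc q) m (m∸n≤m m (suc q)) ≤-refl)
    (trans (colour-top m (m ∸ suc q) m≢0 (<⇒≢ (∸-monoʳ-< (s≤s z≤n) (<⇒≤ q<m))))
           (cong (λ z → W (m + (m + z))) (m∸[m∸n]≡n (<⇒≤ q<m))))

  left : ∀ q → q < m → c (0 , m ∸ q) ≡ W (m + (m + (m + q)))
  left zero _ = trans (colorAt-grid m 0 m z≤n ≤-refl)
    (trans (colour-top m 0 m≢0 (λ ())) (cong (λ z → W (m + (m + z))) (sym (+-identityʳ m))))
  left (suc q) q<m = trans (colorAt-grid m 0 (m ∸ suc q) z≤n (m∸n≤m m (suc q)))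
    (trans (colour-left m (m ∸ suc q) (m>n⇒m∸n≢0 q<m) m≢0 (<⇒≢ (∸-monoʳ-< (s≤s z≤n) (<⇒≤ q<m))))
           (cong (λ z → W (m + (m + (m + z)))) (m∸[m∸n]≡n (<⇒≤ q<m))))

  bottomSide rightSide topSide leftSide : ℕ → ℕ × ℕ
  bottomSide i = (i , 0)
  rightSide j = (m , j)
  topSide i = (m ∸ i , m)
  leftSide j = (0 , m ∸ j)

  length-outer : length (outerFace m) ≡ N
  length-outer = begin
    length (S₁ ++ S₂ ++ S₃ ++ S₄)                         ≡⟨ length-++ S₁ ⟩
    length S₁ + length (S₂ ++ S₃ ++ S₄)                   ≡⟨ cong (length S₁ +_) (length-++ S₂) ⟩
    length S₁ + (length S₂ + length (S₃ ++ S₄))           ≡⟨ cong (λ z → length S₁ + (length S₂ + z)) (length-++ S₃) ⟩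
    length S₁ + (length S₂ + (length S₃ + length S₄))     ≡⟨ cong₂ _+_ (length-applyUpTo bottomSide m) (cong₂ _+_ (length-applyUpTo rightSide m) (cong₂ _+_ (length-applyUpTo topSide m) (length-applyUpTo leftSide m))) ⟩
    N                                                     ∎
    where
    S₁ = applyUpTo bottomSide m
    S₂ = applyUpTo rightSide m
    S₃ = applyUpTo topSide m
    S₄ = applyUpTo leftSide m

  reads : ∀ p → p < N → at (map c (outerFace m)) p ≡ just (W p)
  reads = read-segment c bottomSide m _ (m + (m + m)) W bottom
    (read-segment c rightSide m _ (m + m) (W ∘ (m +_)) right
      (read-segment c topSide m _ m (W ∘ (m +_) ∘ (m +_)) top
        (read-last c leftSide m (W ∘ (m +_) ∘ (m +_) ∘ (m +_)) left)))

  reads-doubled : ∀ i → i < length (outerFace m) + length (outerFace m) →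
    at (map c (outerFace m ++ outerFace m)) i ≡ just (Wcyc N i)
  reads-doubled i i<2B with N ≤? i
  ... | no N≰i = begin
    at (map c (outerFace m ++ outerFace m)) i          ≡⟨ cong (λ z → at z i) (map-++ c (outerFace m) (outerFace m)) ⟩
    at (map c (outerFace m) ++ map c (outerFace m)) i  ≡⟨ at-++ˡ (map c (outerFace m)) _ i (subst (i <_) (sym (trans (length-map c (outerFace m)) length-outer)) i<N) ⟩
    at (map c (outerFace m)) i                         ≡⟨ reads i i<N ⟩
    just (W i)                                         ≡⟨ cong just (Wcyc-lo N i i<N) ⟨
    just (Wcyc N i)                                    ∎
    where
    i<N : i < N
    i<N = ≰⇒> N≰i
  ... | yes N≤i = begin
    at (map c (outerFace m ++ outerFace m)) i          ≡⟨ cong (λ z → at z i) (map-++ c (outerFace m) (outerFace m)) ⟩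
    at (map c (outerFace m) ++ map c (outerFace m)) i  ≡⟨ cong (at (map c (outerFace m) ++ map c (outerFace m))) (sym split) ⟩
    at (map c (outerFace m) ++ map c (outerFace m)) (length (map c (outerFace m)) + (i ∸ N))
                                                       ≡⟨ at-++ʳ (map c (outerFace m)) _ (i ∸ N) ⟩
    at (map c (outerFace m)) (i ∸ N)                   ≡⟨ reads (i ∸ N) i∸N<N ⟩
    just (W (i ∸ N))                                   ≡⟨ cong just (Wcyc-hi N i N≤i) ⟨
    just (Wcyc N i)                                    ∎
    where
    split : length (map c (outerFace m)) + (i ∸ N) ≡ i
    split = trans (cong (_+ (i ∸ N)) (trans (length-map c (outerFace m)) length-outer)) (m+[n∸m]≡n N≤i)
    i∸N<N : i ∸ N < N
    i∸N<N = +-cancelˡ-< N (i ∸ N) N (subst (_< N + N) (sym (m+[n∸m]≡n N≤i)) (subst (i <_) (cong₂ _+_ length-outer length-outer) i<2B))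

  outer-face : ∀ P → FacialPathOf (outerFace m) P → Nonrepetitive (map c P)
  outer-face = facial-nonrep (outerFace m) c (Wcyc N) reads-doubled λ u ℓ 1≤ℓ 2ℓ≤B _ →
    cyclic-squarefree N u ℓ 1≤ℓ (subst (ℓ + ℓ ≤_) length-outer 2ℓ≤B)

outer-face-point : ∀ P → FacialPathOf (outerFace 0) P → Nonrepetitive (map (colorAt (gridColouring 0)) P)
outer-face-point = facial-nonrep (outerFace 0) (colorAt (gridColouring 0)) (λ _ → cB) reads
  λ { u (suc ℓ) _ (s≤s 2ℓ≤0) _ → contradiction (subst (_≤ 0) (+-suc ℓ ℓ) 2ℓ≤0) λ () }
  where
  reads : ∀ i → i < 2 → at (map (colorAt (gridColouring 0)) (outerFace 0 ++ outerFace 0)) i ≡ just cB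
  reads 0 _ = refl
  reads 1 _ = refl
  reads (suc (suc _)) (s≤s (s≤s ()))

facial-nonrepetitive : ∀ m → FacialNonrepetitive {m} (gridColouring m)
facial-nonrepetitive zero P (B , here refl , path) = outer-face-point P path
facial-nonrepetitive (suc m′) P (B , here refl , path) = OuterFace.outer-face m′ P path
facial-nonrepetitive m P (B , there B∈squares , path)
  with i , i∈ , B∈row ← find (∈-concatMap⁻ (λ i → map (λ j → squareFace i j) (upTo m)) {xs = upTo m} B∈squares)
  with j , j∈ , refl ← ∈-map⁻ (λ j → squareFace i j) B∈row =
  square-faces m i j (∈-upTo⁻ i∈) (∈-upTo⁻ j∈) P path

mainTheorem6 : ∀ (n : ℕ) → 1 ≤ n → πf-grid-≤ n 4
mainTheorem6 n _ {m} _ = gridColouring m , facial-nonrepetitive m
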